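{- Let $(P,\rho)$ be a weakly ranked locally finite poset, $\kappa$ a $(P,\rho)$-kernel with right augmented Chow function $F$ and left augmented Chow function $G$. Then (i) for every $s\le t$, $[x^{\rho_{st}}]F_{st}(x)=[x^{\rho_{st}}]G_{st}(x)=[x^{\rho_{st}}]\kappa_{st}(x)$; in particular if $\kappa$ is non-degenerate then $\deg F_{st}=\deg G_{st}=\rho_{st}$ for all $s\le t$; (ii) $F_{st}(x)=x^{\rho_{st}}F_{st}(x^{ -1})$ and $G_{st}(x)=x^{\rho_{st}}G_{st}(x^{ -1})$ for every $s\le t$, i.e. $F^{\mathrm{rev}}=F$ and $G^{\mathrm{rev}}=G$.
   Context: $P$ is a locally finite poset; $\operatorname{Int}(P)$ is its set of closed intervals. A weak rank function is a map $\rho:\operatorname{Int}(P)\to\mathbb{Z}_{\ge0}$, $[s,t]\mapsto\rho_{st}$, with $\rho_{st}>0$ whenever $s<t$ and $\rho_{st}=\rho_{sw}+\rho_{wt}$ for $s\le w\le t$. The incidence algebra $\mathcal{I}(P)$ consists of maps $a$ assigning to each $[s,t]$ a polynomial $a_{st}(x)\in\mathbb{Z}[x]$, with product $(ab)_{st}=\sum_{s\le w\le t}a_{sw}b_{wt}$. $\mathcal{I}_\rho(P)=\{a:\deg a_{st}\le\rho_{st}\}$, and $a^{\mathrm{rev}}_{st}(x)=x^{\rho_{st}}a_{st}(x^{ -1})$. A $(P,\rho)$-kernel is $\kappa\in\mathcal{I}_\rho(P)$ with $\kappa_{ss}=1$ for all $s$ and $\kappa^{ -1}=\kappa^{\mathrm{rev}}$;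 it is non-degenerate if $\deg\kappa_{st}=\rho_{st}$ for all $s\le t$. For $s<t$, $\kappa_{st}$ is divisible by $x-1$; the reduced kernel has $\overline{\kappa}_{st}=\kappa_{st}/(x-1)$ for $s<t$ and $\overline{\kappa}_{ss}=-1$. The Chow function is $\mathrm{H}=-(\overline{\kappa})^{ -1}$. The right KLS function is the unique $f\in\mathcal{I}_\rho(P)$ with $f_{ss}=1$, $\deg f_{st}<\rho_{st}/2$ for $s<t$, $f^{\mathrm{rev}}=\kappa f$; the left KLS function is the unique $g\in\mathcal{I}_\rho(P)$ with $g_{ss}=1$, $\deg g_{st}<\rho_{st}/2$ for $s<t$, $g^{\mathrm{rev}}=g\kappa$. The right augmented Chow function is $F=\mathrm{H}\,f^{\mathrm{rev}}$ and the left augmented Chow function is $G=g^{\mathrm{rev}}\mathrm{H}$. $[x^k]p$ denotes the coefficient of $x^k$ in $p$. -}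

module Defs where

open import Level using (Level; suc; _⊔_)
open import Data.Nat using (ℕ; zero; _<_; _≤_; _≤ᵇ_; _∸_) renaming (suc to sucℕ; _*_ to _*ℕ_)
open import Data.Integer using (ℤ; 0ℤ; 1ℤ; -1ℤ; _+_; _*_; -_)
open import Data.Bool using (if_then_else_)
open import Data.List using (List; foldr; map)
open import Data.List.Membership.Propositional using (_∈_)
open import Data.List.Relation.Unary.Unique.Propositional using (Unique)
open import Data.Product using (_×_)
open import Relation.Binary.PropositionalEquality using (_≡_; _≢_)
open import Relation.Binary.Structures using (IsPartialOrder)

record LocallyFinitePoset (c ℓ : Level) : Set (suc (c ⊔ ℓ)) where
  field
    Carrier        : Set c
    _≤P_           : Carrier → Carrier → Set ℓ
    isPartialOrder : IsPartialOrder _≡_ _≤P_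
    interval       : Carrier → Carrier → List Carrier
    interval-sound    : ∀ s t w → w ∈ interval s t → (s ≤P w) × (w ≤P t)
    interval-complete : ∀ s t w → s ≤P w → w ≤P t → w ∈ interval s t
    interval-unique   : ∀ s t → Unique (interval s t)

  _<P_ : Carrier → Carrier → Set (c ⊔ ℓ)
  s <P t = (s ≤P t) × (s ≢ t)

open LocallyFinitePoset public

-- Weak rank functions (only the values on intervals s ≤ t matter).

record IsWeakRank {c ℓ} (P : LocallyFinitePoset c ℓ)
                  (ρ : Carrier P → Carrier P → ℕ) : Set (c ⊔ ℓ) where
  field
    pos      : ∀ s t → _<P_ P s t → 0 < ρ s t
    additive : ∀ s w t → _≤P_ P s w → _≤P_ P w t → ρ s t ≡ Data.Nat._+_ (ρ s w) (ρ w t)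

-- Polynomials in ℤ[x], represented by their coefficient sequences
-- (coefficient of x^k at index k).  Products are Cauchy products.

Poly : Set
Poly = ℕ → ℤ

sumTo : (ℕ → ℤ) → ℕ → ℤ
sumTo f zero     = 0ℤ
sumTo f (sucℕ n) = sumTo f n + f n

_⋆_ : Poly → Poly → Poly
(p ⋆ q) k = sumTo (λ i → p i * q (k ∸ i)) (sucℕ k)

const : ℤ → Poly
const c zero     = c
const c (sucℕ k) = 0ℤ

x-1 : Poly
x-1 zero            = -1ℤ
x-1 (sucℕ zero)     = 1ℤ
x-1 (sucℕ (sucℕ k)) = 0ℤ

DegLe : Poly → ℕ → Set
DegLe p d = ∀ k → d < k → p k ≡ 0ℤ

HasDeg : Poly → ℕ → Set
HasDeg p d = (p d ≢ 0ℤ) × DegLe p d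

DegLtHalf : Poly → ℕ → Set
DegLtHalf p d = ∀ k → d ≤ 2 *ℕ k → p k ≡ 0ℤ

_≈ₚ_ : Poly → Poly → Set
p ≈ₚ q = ∀ k → p k ≡ q k

-- An element assigns a
-- polynomial to every pair (s,t); only the values on intervals s ≤ t
-- are relevant, and all conditions below are imposed only there.

module _ {c ℓ} (P : LocallyFinitePoset c ℓ) where

  Inc : Set c
  Inc = Carrier P → Carrier P → Poly

  _⊛_ : Inc → Inc → Inc
  (a ⊛ b) s t k = foldr _+_ 0ℤ (map (λ w → (a s w ⋆ b w t) k) (interval P s t))

  -- a^rev_{st}(x) = x^{ρ_st} a_{st}(x^{-1})
  rev : (Carrier P → Carrier P → ℕ) → Inc → Inc
  rev ρ a s t k = if k ≤ᵇ ρ s t then a s t (ρ s t ∸ k) else 0ℤ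

  InIρ : (Carrier P → Carrier P → ℕ) → Inc → Set (c ⊔ ℓ)
  InIρ ρ a = ∀ s t → _≤P_ P s t → DegLe (a s t) (ρ s t)

  IsScalarδ : ℤ → Inc → Set (c ⊔ ℓ)
  IsScalarδ u a = (∀ s → a s s ≈ₚ const u)
                × (∀ s t → _<P_ P s t → a s t ≈ₚ const 0ℤ)

  _≈ᵢ_ : Inc → Inc → Set (c ⊔ ℓ)
  a ≈ᵢ b = ∀ s t → _≤P_ P s t → a s t ≈ₚ b s t

  record IsKernel (ρ : Carrier P → Carrier P → ℕ) (κ : Inc) : Set (c ⊔ ℓ) where
    field
      inIρ     : InIρ ρ κ
      diag     : ∀ s → κ s s ≈ₚ const 1ℤ
      invRight : IsScalarδ 1ℤ (κ ⊛ rev ρ κ)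
      invLeft  : IsScalarδ 1ℤ (rev ρ κ ⊛ κ)

  NonDegenerate : (Carrier P → Carrier P → ℕ) → Inc → Set (c ⊔ ℓ)
  NonDegenerate ρ κ = ∀ s t → _≤P_ P s t → HasDeg (κ s t) (ρ s t)

  IsReducedKernel : Inc → Inc → Set (c ⊔ ℓ)
  IsReducedKernel κ κ̄ = (∀ s → κ̄ s s ≈ₚ const -1ℤ)
                      × (∀ s t → _<P_ P s t → κ s t ≈ₚ (x-1 ⋆ κ̄ s t))

  IsChowFunction : Inc → Inc → Set (c ⊔ ℓ)
  IsChowFunction κ̄ H = IsScalarδ -1ℤ (H ⊛ κ̄) × IsScalarδ -1ℤ (κ̄ ⊛ H)

  record IsRightKLS (ρ : Carrier P → Carrier P → ℕ) (κ f : Inc) : Set (c ⊔ ℓ) where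
    field
      inIρ  : InIρ ρ f
      diag  : ∀ s → f s s ≈ₚ const 1ℤ
      small : ∀ s t → _<P_ P s t → DegLtHalf (f s t) (ρ s t)
      eqn   : rev ρ f ≈ᵢ (κ ⊛ f)

  record IsLeftKLS (ρ : Carrier P → Carrier P → ℕ) (κ g : Inc) : Set (c ⊔ ℓ) where
    field
      inIρ  : InIρ ρ g
      diag  : ∀ s → g s s ≈ₚ const 1ℤ
      small : ∀ s t → _<P_ P s t → DegLtHalf (g s t) (ρ s t)
      eqn   : rev ρ g ≈ᵢ (g ⊛ κ)

  rightAugChow : (Carrier P → Carrier P → ℕ) → Inc → Inc → Inc
  rightAugChow ρ H f = H ⊛ rev ρ f

  leftAugChow : (Carrier P → Carrier P → ℕ) → Inc → Inc → Inc
  leftAugChow ρ H g = rev ρ g ⊛ H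

{-# OPTIONS --safe #-}
-- Write δ for the unit of the incidence algebra and aʳ for reversal.  Evaluating κ κʳ = δ at
-- x = 1 and inducting on rank gives κ(1) = δ, so deg κ̄_st < ρ_st; then H κ̄ = -δ shows, again
-- by induction on rank, that H ∈ I_ρ with [x^ρ_st] H_st = 0 for s < t.  Reversing
-- κ = (x - 1) κ̄ + x δ gives (x - 1) κ̄ʳ + x κʳ = δ, and multiplying by κ on either side and
-- cancelling x - 1 yields κ̄ʳ κ = κ κ̄ʳ = κ̄.  As Hʳ is inverse to -κ̄ʳ, this forces
-- Hʳ = κ H = H κ, whence Fʳ = Hʳ f = H κ f = H fʳ = F, and symmetrically Gʳ = G.
-- For the top coefficient, [x^ρ] F_st = [x^0] F_st = [x^0] H_st because [x^0] fʳ = δ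
-- (deg f < ρ/2), and [x^0] H_st = [x^ρ] κ_st because H = κʳ Hʳ and [x^0] Hʳ = δ.
module Submission where

open import Defs
open import Level using (Level; _⊔_)
open import Data.Nat using (ℕ)
open import Data.Product using (_×_; _,_; proj₁; proj₂; ∃₂; swap)
open import Relation.Binary.PropositionalEquality using (_≡_)

open import Data.Bool using (true; false; if_then_else_)
open import Data.Empty using (⊥; ⊥-elim)
open import Data.Integer as ℤ using (ℤ; 0ℤ; 1ℤ; -1ℤ; _+_; _*_; -_)
import Data.Integer.Properties as ℤ
open import Algebra.Properties.AbelianGroup ℤ.+-0-abelianGroup using () renaming (∙-cancelʳ to +-cancelʳ)
open import Algebra.Properties.CommutativeSemigroup ℤ.+-commutativeSemigroup using () renaming (interchange to +-interchange)
open import Data.Integer.Tactic.RingSolver using (solve-∀)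
open import Data.List using (List; []; _∷_; foldr; map; _++_; concatMap)
open import Data.List.Membership.Propositional using (_∈_; find; lose)
open import Data.List.Membership.Propositional.Properties using (∈-map⁺; ∈-map⁻; ∈-concatMap⁺; ∈-concatMap⁻)
open import Data.List.Membership.Propositional.Properties.WithK using (unique∧set⇒bag)
open import Data.List.Relation.Binary.BagAndSetEquality using (∼bag⇒↭)
open import Data.List.Relation.Binary.Disjoint.Propositional using (Disjoint)
open import Data.List.Relation.Binary.Permutation.Propositional using (_↭_; ↭⇒↭ₛ)
import Data.List.Relation.Binary.Permutation.Propositional.Properties as ↭
open import Data.List.Relation.Binary.Permutation.Setoid.Properties ℤ.≡-setoid using (foldr-commMonoid)
import Data.List.Relation.Unary.All as All
import Data.List.Relation.Unary.All.Properties as All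
import Data.List.Relation.Unary.AllPairs as AllPairs
import Data.List.Relation.Unary.AllPairs.Properties as AllPairs
open import Data.List.Relation.Unary.Any using (here; there)
open import Data.List.Relation.Unary.Unique.Propositional using (Unique; _∷_)
open import Data.List.Relation.Unary.Unique.Propositional.Properties using (Unique[x∷xs]⇒x∉xs; map⁺; concat⁺)
open import Data.Nat as ℕ using (zero; suc; _≤_; _<_; _∸_; z≤n; s≤s) renaming (_+_ to _+ℕ_)
import Data.Nat.Properties as ℕ
open import Data.Product.Properties using (,-injective)
open import Data.Unit using (tt)
open import Function.Base using (_∘_)
open import Function.Bundles using (_⇔_; mk⇔)
open import Relation.Binary.Bundles using (Setoid)
open import Relation.Binary.PropositionalEquality
  using (_≢_; ≢-sym; refl; sym; trans; cong; cong₂; subst; _→-setoid_; module ≡-Reasoning)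
import Relation.Binary.Reasoning.Setoid as SetoidReasoning
open import Relation.Binary.Structures using (IsPartialOrder)
open import Relation.Nullary using (yes; no)
open import Relation.Nullary.Decidable using (decidable-stable)

private variable
  a b : Level
  A B : Set a

-- Finite sums

∑ : List A → (A → ℤ) → ℤ
∑ L F = foldr _+_ 0ℤ (map F L)

syntax ∑ L (λ x → F) = ∑[ x ∈ L ] F

∑-cong : (L : List A) {F G : A → ℤ} → (∀ x → x ∈ L → F x ≡ G x) → ∑ L F ≡ ∑ L G
∑-cong []      F≡G = refl
∑-cong (x ∷ L) F≡G = cong₂ _+_ (F≡G x (here refl)) (∑-cong L (λ y y∈L → F≡G y (there y∈L)))

∑-zero : (L : List A) {F : A → ℤ} → (∀ x → x ∈ L → F x ≡ 0ℤ) → ∑ L F ≡ 0ℤ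
∑-zero []      F≡0 = refl
∑-zero (x ∷ L) F≡0 = cong₂ _+_ (F≡0 x (here refl)) (∑-zero L (λ y y∈L → F≡0 y (there y∈L)))

∑-+ : (L : List A) (F G : A → ℤ) → ∑[ x ∈ L ] (F x + G x) ≡ ∑ L F + ∑ L G
∑-+ []      F G = refl
∑-+ (x ∷ L) F G = trans (cong (F x + G x +_) (∑-+ L F G)) (+-interchange (F x) (G x) (∑ L F) (∑ L G))

∑-*ˡ : (L : List A) (c : ℤ) (F : A → ℤ) → ∑[ x ∈ L ] (c * F x) ≡ c * ∑ L F
∑-*ˡ []      c F = sym (ℤ.*-zeroʳ c)
∑-*ˡ (x ∷ L) c F = trans (cong (c * F x +_) (∑-*ˡ L c F)) (sym (ℤ.*-distribˡ-+ c (F x) (∑ L F)))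

∑-*ʳ : (L : List A) (c : ℤ) (F : A → ℤ) → ∑[ x ∈ L ] (F x * c) ≡ ∑ L F * c
∑-*ʳ L c F = trans (∑-cong L (λ x _ → ℤ.*-comm (F x) c)) (trans (∑-*ˡ L c F) (ℤ.*-comm c (∑ L F)))

∑-++ : (L M : List A) (F : A → ℤ) → ∑ (L ++ M) F ≡ ∑ L F + ∑ M F
∑-++ []      M F = sym (ℤ.+-identityˡ (∑ M F))
∑-++ (x ∷ L) M F = trans (cong (F x +_) (∑-++ L M F)) (sym (ℤ.+-assoc (F x) (∑ L F) (∑ M F)))

∑-map : (f : A → B) (L : List A) (F : B → ℤ) → ∑ (map f L) F ≡ ∑[ x ∈ L ] F (f x)
∑-map f []      F = refl
∑-map f (x ∷ L) F = cong (F (f x) +_) (∑-map f L F)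

∑-↭ : {L M : List A} (F : A → ℤ) → L ↭ M → ∑ L F ≡ ∑ M F
∑-↭ F L↭M = foldr-commMonoid ℤ.+-0-isCommutativeMonoid (↭⇒↭ₛ (↭.map⁺ F L↭M))

∑-unique-set : {L M : List A} (F : A → ℤ) → Unique L → Unique M →
               (∀ {x} → x ∈ L ⇔ x ∈ M) → ∑ L F ≡ ∑ M F
∑-unique-set F uL uM L≈M = ∑-↭ F (∼bag⇒↭ (unique∧set⇒bag uL uM L≈M))

private
  ∈-tail⇒≢-head : {x y : A} {L : List A} → Unique (x ∷ L) → y ∈ L → y ≢ x
  ∈-tail⇒≢-head u y∈L refl = Unique[x∷xs]⇒x∉xs u y∈L

∑-supported : {L : List A} {x : A} (F : A → ℤ) → Unique L → x ∈ L →
              (∀ y → y ∈ L → y ≢ x → F y ≡ 0ℤ) → ∑ L F ≡ F x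
∑-supported {L = x ∷ L} F u (here refl) F≡0 =
  trans (cong (F x +_) (∑-zero L (λ y y∈L → F≡0 y (there y∈L) (∈-tail⇒≢-head u y∈L))))
        (ℤ.+-identityʳ (F x))
∑-supported {L = y ∷ L} F u@(_ ∷ uL) (there x∈L) F≡0 =
  trans (cong (_+ ∑ L F) (F≡0 y (here refl) (≢-sym (∈-tail⇒≢-head u x∈L))))
        (trans (ℤ.+-identityˡ (∑ L F)) (∑-supported F uL x∈L (λ z z∈L → F≡0 z (there z∈L))))

∑-supported₂ : {L : List A} {x y : A} (F : A → ℤ) → Unique L → x ∈ L → y ∈ L → x ≢ y →
               (∀ z → z ∈ L → z ≢ x → z ≢ y → F z ≡ 0ℤ) → ∑ L F ≡ F x + F y
∑-supported₂ F u (here refl) (here refl) x≢y F≡0 = ⊥-elim (x≢y refl)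
∑-supported₂ {L = x ∷ L} F u@(_ ∷ uL) (here refl) (there y∈L) x≢y F≡0 =
  cong (F x +_) (∑-supported F uL y∈L (λ z z∈L → F≡0 z (there z∈L) (∈-tail⇒≢-head u z∈L)))
∑-supported₂ {L = y ∷ L} F u@(_ ∷ uL) (there x∈L) (here refl) x≢y F≡0 =
  trans (cong (F y +_) (∑-supported F uL x∈L (λ z z∈L z≢x → F≡0 z (there z∈L) z≢x (∈-tail⇒≢-head u z∈L))))
        (ℤ.+-comm (F y) _)
∑-supported₂ {L = z ∷ L} F u@(_ ∷ uL) (there x∈L) (there y∈L) x≢y F≡0 =
  trans (cong (_+ ∑ L F) (F≡0 z (here refl) (≢-sym (∈-tail⇒≢-head u x∈L)) (≢-sym (∈-tail⇒≢-head u y∈L))))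
        (trans (ℤ.+-identityˡ (∑ L F)) (∑-supported₂ F uL x∈L y∈L x≢y (λ w w∈L → F≡0 w (there w∈L))))

private
  tagged : {C : Set a} → (A → B → C) → List A → (A → List B) → List C
  tagged f L g = concatMap (λ x → map (f x) (g x)) L

  ∑-tagged : {C : Set a} (f : A → B → C) (L : List A) (g : A → List B) (F : C → ℤ) →
             ∑ (tagged f L g) F ≡ ∑[ x ∈ L ] ∑[ y ∈ g x ] F (f x y)
  ∑-tagged f []      g F = refl
  ∑-tagged f (x ∷ L) g F =
    trans (∑-++ (map (f x) (g x)) (tagged f L g) F) (cong₂ _+_ (∑-map (f x) (g x) F) (∑-tagged f L g F))

  ∈-tagged⁺ : {C : Set a} (f : A → B → C) {L : List A} {g : A → List B} {x : A} {y : B} →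
              x ∈ L → y ∈ g x → f x y ∈ tagged f L g
  ∈-tagged⁺ f {g = g} x∈L y∈gx = ∈-concatMap⁺ (λ x → map (f x) (g x)) (lose x∈L (∈-map⁺ (f _) y∈gx))

  ∈-tagged⁻ : {C : Set a} (f : A → B → C) (L : List A) {g : A → List B} {z : C} →
              z ∈ tagged f L g → ∃₂ λ x y → x ∈ L × y ∈ g x × z ≡ f x y
  ∈-tagged⁻ f L {g} z∈ with find (∈-concatMap⁻ (λ x → map (f x) (g x)) {xs = L} z∈)
  ... | x , x∈L , z∈row with ∈-map⁻ (f x) z∈row
  ... | y , y∈gx , z≡fxy = x , y , x∈L , y∈gx , z≡fxy

  tagged-unique : {C : Set a} (f : A → B → C) {L : List A} {g : A → List B} →
                  (∀ {x x′ y y′} → f x y ≡ f x′ y′ → x ≡ x′ × y ≡ y′) →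
                  Unique L → (∀ x → Unique (g x)) → Unique (tagged f L g)
  tagged-unique f {L} {g} f-injective uL ug =
    concat⁺ (All.map⁺ (All.tabulate (λ {x} _ → map⁺ (proj₂ ∘ f-injective) (ug x))))
            (AllPairs.map⁺ (AllPairs.map rows-disjoint uL))
    where
    rows-disjoint : ∀ {x x′} → x ≢ x′ → Disjoint (map (f x) (g x)) (map (f x′) (g x′))
    rows-disjoint x≢x′ (v∈row , v∈row′) with ∈-map⁻ (f _) v∈row | ∈-map⁻ (f _) v∈row′
    ... | y , _ , refl | y′ , _ , fxy≡fx′y′ = x≢x′ (proj₁ (f-injective fxy≡fx′y′))

∑-fubini : {L : List A} {M : List B} {g : A → List B} {h : B → List A} →
           Unique L → Unique M → (∀ x → Unique (g x)) → (∀ y → Unique (h y)) →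
           (∀ {x y} → x ∈ L → y ∈ g x → y ∈ M × x ∈ h y) →
           (∀ {x y} → y ∈ M → x ∈ h y → x ∈ L × y ∈ g x) →
           (T : A → B → ℤ) → ∑[ x ∈ L ] ∑[ y ∈ g x ] T x y ≡ ∑[ y ∈ M ] ∑[ x ∈ h y ] T x y
∑-fubini {L = L} {M} {g} {h} uL uM ug uh to from T =
  trans (sym (∑-tagged _,_ L g T′))
  (trans (∑-unique-set T′ (tagged-unique _,_ ,-injective uL ug)
                          (tagged-unique (λ y x → x , y) (swap ∘ ,-injective) uM uh)
                          (mk⇔ forth back))
         (∑-tagged (λ y x → x , y) M h T′))
  where
  T′ : _ × _ → ℤ
  T′ (x , y) = T x y
  forth : ∀ {z} → z ∈ tagged _,_ L g → z ∈ tagged (λ y x → x , y) M h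
  forth z∈ with ∈-tagged⁻ _,_ L z∈
  ... | x , y , x∈L , y∈gx , refl = let y∈M , x∈hy = to x∈L y∈gx in ∈-tagged⁺ (λ y x → x , y) y∈M x∈hy
  back : ∀ {z} → z ∈ tagged (λ y x → x , y) M h → z ∈ tagged _,_ L g
  back z∈ with ∈-tagged⁻ (λ y x → x , y) M z∈
  ... | y , x , y∈M , x∈hy , refl = let x∈L , y∈gx = from y∈M x∈hy in ∈-tagged⁺ _,_ x∈L y∈gx

sumTo-cong : ∀ n {f g : ℕ → ℤ} → (∀ i → i < n → f i ≡ g i) → sumTo f n ≡ sumTo g n
sumTo-cong zero    f≡g = refl
sumTo-cong (suc n) f≡g = cong₂ _+_ (sumTo-cong n (λ i i<n → f≡g i (ℕ.m<n⇒m<1+n i<n))) (f≡g n ℕ.≤-refl)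

sumTo-zero : ∀ n {f : ℕ → ℤ} → (∀ i → i < n → f i ≡ 0ℤ) → sumTo f n ≡ 0ℤ
sumTo-zero zero    f≡0 = refl
sumTo-zero (suc n) f≡0 = cong₂ _+_ (sumTo-zero n (λ i i<n → f≡0 i (ℕ.m<n⇒m<1+n i<n))) (f≡0 n ℕ.≤-refl)

sumTo-*ˡ : ∀ n (c : ℤ) (f : ℕ → ℤ) → sumTo (λ i → c * f i) n ≡ c * sumTo f n
sumTo-*ˡ zero    c f = sym (ℤ.*-zeroʳ c)
sumTo-*ˡ (suc n) c f = trans (cong (_+ c * f n) (sumTo-*ˡ n c f)) (sym (ℤ.*-distribˡ-+ c (sumTo f n) (f n)))

sumTo-*ʳ : ∀ n (c : ℤ) (f : ℕ → ℤ) → sumTo (λ i → f i * c) n ≡ sumTo f n * c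
sumTo-*ʳ n c f = trans (sumTo-cong n (λ i _ → ℤ.*-comm (f i) c)) (trans (sumTo-*ˡ n c f) (ℤ.*-comm c (sumTo f n)))

sumTo-∑ : (L : List A) (T : A → ℕ → ℤ) (n : ℕ) →
          sumTo (λ i → ∑[ x ∈ L ] T x i) n ≡ ∑[ x ∈ L ] sumTo (T x) n
sumTo-∑ L T zero    = sym (∑-zero L (λ _ _ → refl))
sumTo-∑ L T (suc n) =
  trans (cong (_+ ∑[ x ∈ L ] T x n) (sumTo-∑ L T n)) (sym (∑-+ L (λ x → sumTo (T x) n) (λ x → T x n)))

sumTo-+ : ∀ n (f g : ℕ → ℤ) → sumTo (λ i → f i + g i) n ≡ sumTo f n + sumTo g n
sumTo-+ zero    f g = refl
sumTo-+ (suc n) f g =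
  trans (cong (_+ (f n + g n)) (sumTo-+ n f g)) (+-interchange (sumTo f n) (sumTo g n) (f n) (g n))

sumTo-swap : ∀ m n (T : ℕ → ℕ → ℤ) →
             sumTo (λ i → sumTo (T i) n) m ≡ sumTo (λ j → sumTo (λ i → T i j) m) n
sumTo-swap zero    n T = sym (sumTo-zero n (λ _ _ → refl))
sumTo-swap (suc m) n T =
  trans (cong (_+ sumTo (T m) n) (sumTo-swap m n T)) (sym (sumTo-+ n (λ j → sumTo (λ i → T i j) m) (T m)))

sumTo-shift : ∀ n (f : ℕ → ℤ) → sumTo f (suc n) ≡ f 0 + sumTo (λ i → f (suc i)) n
sumTo-shift zero    f = trans (ℤ.+-identityˡ (f 0)) (sym (ℤ.+-identityʳ (f 0)))
sumTo-shift (suc n) f = trans (cong (_+ f (suc n)) (sumTo-shift n f)) (ℤ.+-assoc (f 0) _ _)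

sumTo-reverse : ∀ n (f : ℕ → ℤ) → sumTo f (suc n) ≡ sumTo (λ i → f (n ∸ i)) (suc n)
sumTo-reverse zero    f = refl
sumTo-reverse (suc n) f =
  trans (cong (_+ f (suc n)) (sumTo-reverse n f))
        (trans (ℤ.+-comm _ (f (suc n))) (sym (sumTo-shift (suc n) (λ i → f (suc n ∸ i)))))

sumTo-extend : ∀ m n (f : ℕ → ℤ) → m ≤ n → (∀ i → m ≤ i → f i ≡ 0ℤ) → sumTo f n ≡ sumTo f m
sumTo-extend m zero    f z≤n  f≡0 = refl
sumTo-extend m (suc n) f m≤1+n f≡0 with m ℕ.≟ suc n
... | yes refl = refl
... | no m≢1+n = trans (cong₂ _+_ (sumTo-extend m n f m≤n f≡0) (f≡0 n m≤n)) (ℤ.+-identityʳ _)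
  where
  m≤n : m ≤ n
  m≤n = ℕ.≤-pred (ℕ.≤∧≢⇒< m≤1+n m≢1+n)

kronecker : ℕ → ℕ → ℤ
kronecker m n with m ℕ.≟ n
... | yes _ = 1ℤ
... | no  _ = 0ℤ

kronecker-≡ : ∀ {m n} → m ≡ n → kronecker m n ≡ 1ℤ
kronecker-≡ {m} {n} m≡n with m ℕ.≟ n
... | yes _   = refl
... | no  m≢n = ⊥-elim (m≢n m≡n)

kronecker-≢ : ∀ {m n} → m ≢ n → kronecker m n ≡ 0ℤ
kronecker-≢ {m} {n} m≢n with m ℕ.≟ n
... | yes m≡n = ⊥-elim (m≢n m≡n)
... | no  _   = refl

kronecker-cong : ∀ {m n m′ n′} → (m ≡ n → m′ ≡ n′) → (m′ ≡ n′ → m ≡ n) →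
                 kronecker m n ≡ kronecker m′ n′
kronecker-cong {m} {n} to from with m ℕ.≟ n
... | yes m≡n = sym (kronecker-≡ (to m≡n))
... | no  m≢n = sym (kronecker-≢ (m≢n ∘ from))

sumTo-supported : ∀ {n j} (f : ℕ → ℤ) → j < n → (∀ i → i < n → i ≢ j → f i ≡ 0ℤ) → sumTo f n ≡ f j
sumTo-supported {suc n} {j} f j<1+n f≡0 with j ℕ.≟ n
... | yes refl = trans (cong (_+ f j) (sumTo-zero n (λ i i<n → f≡0 i (ℕ.m<n⇒m<1+n i<n) (ℕ.<⇒≢ i<n))))
                       (ℤ.+-identityˡ (f j))
... | no  j≢n  = trans (cong₂ _+_ (sumTo-supported f (ℕ.≤∧≢⇒< (ℕ.≤-pred j<1+n) j≢n)
                                                    (λ i i<n → f≡0 i (ℕ.m<n⇒m<1+n i<n)))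
                                  (f≡0 n ℕ.≤-refl (≢-sym j≢n)))
                       (ℤ.+-identityʳ (f j))

-- Power series

module ≈ₚ-Reasoning = SetoidReasoning (ℕ →-setoid ℤ)

shift : Poly → Poly
shift p i = p (suc i)

infixl 6 _⊕_
_⊕_ : Poly → Poly → Poly
(p ⊕ q) i = p i + q i

infixl 7 _·_
_·_ : ℤ → Poly → Poly
(c · p) i = c * p i

X : Poly
X zero          = 0ℤ
X (suc zero)    = 1ℤ
X (suc (suc k)) = 0ℤ

const0 : const 0ℤ ≈ₚ (λ _ → 0ℤ)
const0 zero    = refl
const0 (suc k) = refl

⋆-cong : ∀ {p p′ q q′} → p ≈ₚ p′ → q ≈ₚ q′ → (p ⋆ q) ≈ₚ (p′ ⋆ q′)
⋆-cong p≈p′ q≈q′ k = sumTo-cong (suc k) (λ i _ → cong₂ _*_ (p≈p′ i) (q≈q′ (k ∸ i)))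

⋆-congˡ : ∀ p {q q′} → q ≈ₚ q′ → (p ⋆ q) ≈ₚ (p ⋆ q′)
⋆-congˡ p = ⋆-cong {p = p} (λ _ → refl)

⋆-congʳ : ∀ q {p p′} → p ≈ₚ p′ → (p ⋆ q) ≈ₚ (p′ ⋆ q)
⋆-congʳ q p≈p′ = ⋆-cong {q = q} p≈p′ (λ _ → refl)

⋆-coeff₀ : ∀ p q → (p ⋆ q) 0 ≡ p 0 * q 0
⋆-coeff₀ p q = ℤ.+-identityˡ (p 0 * q 0)

⋆-coeffˢ : ∀ p q k → (p ⋆ q) (suc k) ≡ p 0 * q (suc k) + (shift p ⋆ q) k
⋆-coeffˢ p q k = sumTo-shift (suc k) (λ i → p i * q (suc k ∸ i))

⋆-coeffˢ′ : ∀ p q k → (p ⋆ q) (suc k) ≡ (p ⋆ shift q) k + p (suc k) * q 0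
⋆-coeffˢ′ p q k = cong₂ _+_
  (sumTo-cong (suc k) (λ i i≤k → cong (λ j → p i * q j) (ℕ.+-∸-assoc 1 (ℕ.≤-pred i≤k))))
  (cong (λ j → p (suc k) * q j) (ℕ.n∸n≡0 k))

⋆-comm : ∀ p q → (p ⋆ q) ≈ₚ (q ⋆ p)
⋆-comm p q zero    = trans (⋆-coeff₀ p q) (trans (ℤ.*-comm (p 0) (q 0)) (sym (⋆-coeff₀ q p)))
⋆-comm p q (suc k) = begin
  (p ⋆ q) (suc k)                       ≡⟨ ⋆-coeffˢ p q k ⟩
  p 0 * q (suc k) + (shift p ⋆ q) k     ≡⟨ cong₂ _+_ (ℤ.*-comm (p 0) (q (suc k))) (⋆-comm (shift p) q k) ⟩
  q (suc k) * p 0 + (q ⋆ shift p) k     ≡⟨ ℤ.+-comm (q (suc k) * p 0) _ ⟩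
  (q ⋆ shift p) k + q (suc k) * p 0     ≡⟨ sym (⋆-coeffˢ′ q p k) ⟩
  (q ⋆ p) (suc k)                       ∎
  where open ≡-Reasoning

⋆-distribʳ-⊕ : ∀ p p′ q → ((p ⊕ p′) ⋆ q) ≈ₚ (p ⋆ q ⊕ p′ ⋆ q)
⋆-distribʳ-⊕ p p′ q k =
  trans (sumTo-cong (suc k) (λ i _ → ℤ.*-distribʳ-+ (q (k ∸ i)) (p i) (p′ i))) (sumTo-+ (suc k) _ _)

⋆-distribˡ-⊕ : ∀ p q q′ → (p ⋆ (q ⊕ q′)) ≈ₚ (p ⋆ q ⊕ p ⋆ q′)
⋆-distribˡ-⊕ p q q′ k =
  trans (sumTo-cong (suc k) (λ i _ → ℤ.*-distribˡ-+ (p i) (q (k ∸ i)) (q′ (k ∸ i)))) (sumTo-+ (suc k) _ _)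

·-⋆ : ∀ c p q → ((c · p) ⋆ q) ≈ₚ (c · (p ⋆ q))
·-⋆ c p q k = trans (sumTo-cong (suc k) (λ i _ → ℤ.*-assoc c (p i) (q (k ∸ i)))) (sumTo-*ˡ (suc k) c _)

⋆-· : ∀ c p q → (p ⋆ (c · q)) ≈ₚ (c · (p ⋆ q))
⋆-· c p q k = trans (⋆-comm p (c · q) k) (trans (·-⋆ c q p k) (cong (c *_) (⋆-comm q p k)))

⋆-assoc : ∀ p q r → ((p ⋆ q) ⋆ r) ≈ₚ (p ⋆ (q ⋆ r))
⋆-assoc p q r zero = begin
  ((p ⋆ q) ⋆ r) 0       ≡⟨ trans (⋆-coeff₀ (p ⋆ q) r) (cong (_* r 0) (⋆-coeff₀ p q)) ⟩
  p 0 * q 0 * r 0       ≡⟨ ℤ.*-assoc (p 0) (q 0) (r 0) ⟩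
  p 0 * (q 0 * r 0)     ≡⟨ sym (trans (⋆-coeff₀ p (q ⋆ r)) (cong (p 0 *_) (⋆-coeff₀ q r))) ⟩
  (p ⋆ (q ⋆ r)) 0       ∎
  where open ≡-Reasoning
⋆-assoc p q r (suc k) = begin
  ((p ⋆ q) ⋆ r) (suc k)
    ≡⟨ ⋆-coeffˢ (p ⋆ q) r k ⟩
  (p ⋆ q) 0 * r (suc k) + (shift (p ⋆ q) ⋆ r) k
    ≡⟨ cong₂ _+_ (cong (_* r (suc k)) (⋆-coeff₀ p q)) (⋆-congʳ r (⋆-coeffˢ p q) k) ⟩
  p 0 * q 0 * r (suc k) + ((p 0 · shift q ⊕ shift p ⋆ q) ⋆ r) k
    ≡⟨ cong (p 0 * q 0 * r (suc k) +_) (trans (⋆-distribʳ-⊕ (p 0 · shift q) (shift p ⋆ q) r k)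
                                              (cong₂ _+_ (·-⋆ (p 0) (shift q) r k) (⋆-assoc (shift p) q r k))) ⟩
  p 0 * q 0 * r (suc k) + (p 0 * (shift q ⋆ r) k + (shift p ⋆ (q ⋆ r)) k)
    ≡⟨ regroup (p 0) (q 0) (r (suc k)) ((shift q ⋆ r) k) ((shift p ⋆ (q ⋆ r)) k) ⟩
  p 0 * (q 0 * r (suc k) + (shift q ⋆ r) k) + (shift p ⋆ (q ⋆ r)) k
    ≡⟨ cong (λ c → p 0 * c + (shift p ⋆ (q ⋆ r)) k) (sym (⋆-coeffˢ q r k)) ⟩
  p 0 * (q ⋆ r) (suc k) + (shift p ⋆ (q ⋆ r)) k
    ≡⟨ sym (⋆-coeffˢ p (q ⋆ r) k) ⟩
  (p ⋆ (q ⋆ r)) (suc k) ∎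
  where
  open ≡-Reasoning
  regroup : ∀ a b c d e → a * b * c + (a * d + e) ≡ a * (b * c + d) + e
  regroup = solve-∀

const-⋆ : ∀ c p → (const c ⋆ p) ≈ₚ (c · p)
const-⋆ c p zero    = ⋆-coeff₀ (const c) p
const-⋆ c p (suc k) =
  trans (⋆-coeffˢ (const c) p k)
        (trans (cong (c * p (suc k) +_) (sumTo-zero (suc k) (λ _ _ → refl))) (ℤ.+-identityʳ _))

⋆-const : ∀ c p → (p ⋆ const c) ≈ₚ (c · p)
⋆-const c p k = trans (⋆-comm p (const c) k) (const-⋆ c p k)

X-⋆ : ∀ p k → (X ⋆ p) (suc k) ≡ p k
X-⋆ p k = trans (⋆-coeffˢ X p k)
  (trans (ℤ.+-identityˡ _)
  (trans (⋆-congʳ p shift-X≈1 k) (trans (const-⋆ 1ℤ p k) (ℤ.*-identityˡ (p k)))))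
  where
  shift-X≈1 : shift X ≈ₚ const 1ℤ
  shift-X≈1 zero    = refl
  shift-X≈1 (suc i) = refl

x-1-⋆₀ : ∀ p → (x-1 ⋆ p) 0 ≡ - p 0
x-1-⋆₀ p = trans (⋆-coeff₀ x-1 p) (ℤ.-1*i≡-i (p 0))

x-1-⋆ˢ : ∀ p k → (x-1 ⋆ p) (suc k) ≡ - p (suc k) + p k
x-1-⋆ˢ p k = trans (⋆-coeffˢ x-1 p k) (cong₂ _+_ (ℤ.-1*i≡-i (p (suc k)))
  (trans (⋆-congʳ p shift-x-1≈1 k) (trans (const-⋆ 1ℤ p k) (ℤ.*-identityˡ (p k)))))
  where
  shift-x-1≈1 : shift x-1 ≈ₚ const 1ℤ
  shift-x-1≈1 zero    = refl
  shift-x-1≈1 (suc i) = refl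

x-1-⋆-telescopes : ∀ q k → sumTo (x-1 ⋆ q) (suc k) ≡ - q k
x-1-⋆-telescopes q zero    = trans (ℤ.+-identityˡ _) (x-1-⋆₀ q)
x-1-⋆-telescopes q (suc k) =
  trans (cong₂ _+_ (x-1-⋆-telescopes q k) (x-1-⋆ˢ q k)) (cancel (q k) (q (suc k)))
  where
  cancel : ∀ a b → - a + (- b + a) ≡ - b
  cancel = solve-∀

x-1-⋆-cancel : ∀ {p q} → (x-1 ⋆ p) ≈ₚ (x-1 ⋆ q) → p ≈ₚ q
x-1-⋆-cancel {p} {q} eq k = ℤ.neg-injective (begin
  - p k                      ≡⟨ sym (x-1-⋆-telescopes p k) ⟩
  sumTo (x-1 ⋆ p) (suc k)    ≡⟨ sumTo-cong (suc k) (λ i _ → eq i) ⟩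
  sumTo (x-1 ⋆ q) (suc k)    ≡⟨ x-1-⋆-telescopes q k ⟩
  - q k                      ∎)
  where open ≡-Reasoning

x-1-⋆-const-1⊕X : ((x-1 ⋆ const -1ℤ) ⊕ (X ⋆ const 1ℤ)) ≈ₚ const 1ℤ
x-1-⋆-const-1⊕X k = trans (cong₂ _+_ (⋆-const -1ℤ x-1 k) (⋆-const 1ℤ X k)) (coefficients k)
  where
  coefficients : ∀ k → -1ℤ * x-1 k + 1ℤ * X k ≡ const 1ℤ k
  coefficients zero          = refl
  coefficients (suc zero)    = refl
  coefficients (suc (suc k)) = refl

∑-⋆ : (L : List A) (G : A → Poly) (q : Poly) →
      ((λ i → ∑[ x ∈ L ] G x i) ⋆ q) ≈ₚ (λ k → ∑[ x ∈ L ] (G x ⋆ q) k)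
∑-⋆ L G q k = trans (sumTo-cong (suc k) (λ i _ → sym (∑-*ʳ L (q (k ∸ i)) (λ x → G x i))))
                    (sumTo-∑ L (λ x i → G x i * q (k ∸ i)) (suc k))

⋆-∑ : (L : List A) (G : A → Poly) (p : Poly) →
      (p ⋆ (λ i → ∑[ x ∈ L ] G x i)) ≈ₚ (λ k → ∑[ x ∈ L ] (p ⋆ G x) k)
⋆-∑ L G p k = trans (sumTo-cong (suc k) (λ i _ → sym (∑-*ˡ L (p i) (λ x → G x (k ∸ i)))))
                    (sumTo-∑ L (λ x i → p i * G x (k ∸ i)) (suc k))

-- deg p < n.  DegLe p d unfolds to DegLt p (suc d).
DegLt : Poly → ℕ → Set
DegLt p n = ∀ k → n ≤ k → p k ≡ 0ℤ

⋆-DegLt : ∀ {p q a b} → DegLe p a → DegLt q b → DegLt (p ⋆ q) (a +ℕ b)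
⋆-DegLt {p} {q} {a} {b} p≤a q<b k a+b≤k = sumTo-zero (suc k) term
  where
  term : ∀ i → i < suc k → p i * q (k ∸ i) ≡ 0ℤ
  term i _ with i ℕ.≤? a
  ... | yes i≤a = trans (cong (p i *_) (q<b (k ∸ i) (ℕ.m+n≤o⇒m≤o∸n b (b+i≤k i≤a)))) (ℤ.*-zeroʳ (p i))
    where
    b+i≤k : i ≤ a → b +ℕ i ≤ k
    b+i≤k i≤a = ℕ.≤-trans (ℕ.≤-reflexive (ℕ.+-comm b i)) (ℕ.≤-trans (ℕ.+-monoˡ-≤ b i≤a) a+b≤k)
  ... | no i≰a  = cong (_* q (k ∸ i)) (p≤a i (ℕ.≰⇒> i≰a))

DegLe-⋆ : ∀ {p q a b} → DegLe p a → DegLe q b → DegLe (p ⋆ q) (a +ℕ b)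
DegLe-⋆ {a = a} {b} p≤a q≤b k a+b<k = ⋆-DegLt p≤a q≤b k (ℕ.≤-trans (ℕ.≤-reflexive (ℕ.+-suc a b)) a+b<k)

DegLe-x-1 : DegLe x-1 1
DegLe-x-1 (suc zero)    (s≤s ())
DegLe-x-1 (suc (suc k)) _ = refl

DegLtHalf⇒top-vanishes : ∀ {p d} → DegLtHalf p d → p d ≡ 0ℤ
DegLtHalf⇒top-vanishes {d = d} p<d/2 = p<d/2 d (ℕ.m≤m+n d (d +ℕ 0))

-- Unlike the convolution sum, this sum over the box [0, a] × [0, b] is symmetric under
-- i ↦ a ∸ i, j ↦ b ∸ j.
rectangle : Poly → Poly → ℕ → ℕ → ℕ → ℤ
rectangle p q a b n = sumTo (λ i → sumTo (λ j → kronecker (i +ℕ j) n * (p i * q j)) (suc b)) (suc a)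

⋆-rectangle : ∀ {p q a b} → DegLe p a → DegLe q b → ∀ n → (p ⋆ q) n ≡ rectangle p q a b n
⋆-rectangle {p} {q} {a} {b} p≤a q≤b n = begin
  (p ⋆ q) n
    ≡⟨ sumTo-cong (suc n) (λ i i≤n → sym (column-on-diagonal i (ℕ.≤-pred i≤n))) ⟩
  sumTo column (suc n)
    ≡⟨ sym (sumTo-extend (suc n) (suc M) column (s≤s (ℕ.m≤n+m n (a +ℕ b))) (λ i n<i → column-beyond i n<i)) ⟩
  sumTo column (suc M)
    ≡⟨ sumTo-extend (suc a) (suc M) column (s≤s a≤M) (λ i a<i → sumTo-zero (suc M) (λ j _ → p-beyond i j a<i)) ⟩
  sumTo column (suc a)
    ≡⟨ sumTo-cong (suc a) (λ i _ → sumTo-extend (suc b) (suc M) (term i) (s≤s b≤M) (λ j b<j → q-beyond i j b<j)) ⟩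
  rectangle p q a b n ∎
  where
  open ≡-Reasoning
  M : ℕ
  M = a +ℕ b +ℕ n
  a≤M : a ≤ M
  a≤M = ℕ.≤-trans (ℕ.m≤m+n a b) (ℕ.m≤m+n (a +ℕ b) n)
  b≤M : b ≤ M
  b≤M = ℕ.≤-trans (ℕ.m≤n+m b a) (ℕ.m≤m+n (a +ℕ b) n)
  term : ℕ → ℕ → ℤ
  term i j = kronecker (i +ℕ j) n * (p i * q j)
  column : ℕ → ℤ
  column i = sumTo (term i) (suc M)
  column-on-diagonal : ∀ i → i ≤ n → column i ≡ p i * q (n ∸ i)
  column-on-diagonal i i≤n =
    trans (sumTo-supported (term i) (s≤s (ℕ.≤-trans (ℕ.m∸n≤m n i) (ℕ.m≤n+m n (a +ℕ b))))
            (λ j _ j≢n∸i → trans (cong (_* (p i * q j)) (kronecker-≢ (λ i+j≡n → j≢n∸i (off i+j≡n))))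
                                 (ℤ.*-zeroˡ (p i * q j))))
          (trans (cong (_* (p i * q (n ∸ i))) (kronecker-≡ (ℕ.m+[n∸m]≡n i≤n))) (ℤ.*-identityˡ _))
    where
    off : ∀ {j} → i +ℕ j ≡ n → j ≡ n ∸ i
    off {j} i+j≡n = trans (sym (ℕ.m+n∸m≡n i j)) (cong (_∸ i) i+j≡n)
  column-beyond : ∀ i → suc n ≤ i → column i ≡ 0ℤ
  column-beyond i n<i = sumTo-zero (suc M) (λ j _ →
    trans (cong (_* (p i * q j)) (kronecker-≢ (λ i+j≡n → ℕ.<⇒≱ n<i (ℕ.m+n≤o⇒m≤o i (ℕ.≤-reflexive i+j≡n)))))
          (ℤ.*-zeroˡ (p i * q j)))
  p-beyond : ∀ i j → suc a ≤ i → term i j ≡ 0ℤ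
  p-beyond i j a<i = trans (cong (λ c → kronecker (i +ℕ j) n * (c * q j)) (p≤a i a<i))
                           (trans (cong (kronecker (i +ℕ j) n *_) (ℤ.*-zeroˡ (q j))) (ℤ.*-zeroʳ (kronecker (i +ℕ j) n)))
  q-beyond : ∀ i j → suc b ≤ j → term i j ≡ 0ℤ
  q-beyond i j b<j = trans (cong (λ c → kronecker (i +ℕ j) n * (p i * c)) (q≤b j b<j))
                           (trans (cong (kronecker (i +ℕ j) n *_) (ℤ.*-zeroʳ (p i))) (ℤ.*-zeroʳ (kronecker (i +ℕ j) n)))

sumTo-⋆ : ∀ {p q a b} → DegLe p a → DegLe q b →
          sumTo (p ⋆ q) (suc (a +ℕ b)) ≡ sumTo p (suc a) * sumTo q (suc b)
sumTo-⋆ {p} {q} {a} {b} p≤a q≤b = begin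
  sumTo (p ⋆ q) (suc (a +ℕ b))
    ≡⟨ sumTo-cong (suc (a +ℕ b)) (λ n _ → ⋆-rectangle p≤a q≤b n) ⟩
  sumTo (rectangle p q a b) (suc (a +ℕ b))
    ≡⟨ sumTo-swap (suc (a +ℕ b)) (suc a) _ ⟩
  sumTo (λ i → sumTo (λ n → sumTo (λ j → kronecker (i +ℕ j) n * (p i * q j)) (suc b)) (suc (a +ℕ b))) (suc a)
    ≡⟨ sumTo-cong (suc a) (λ i i≤a → trans (sumTo-swap (suc (a +ℕ b)) (suc b) _)
                                           (sumTo-cong (suc b) (λ j j≤b → diagonal-hit (ℕ.≤-pred i≤a) (ℕ.≤-pred j≤b)))) ⟩
  sumTo (λ i → sumTo (λ j → p i * q j) (suc b)) (suc a)
    ≡⟨ sumTo-cong (suc a) (λ i _ → sumTo-*ˡ (suc b) (p i) q) ⟩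
  sumTo (λ i → p i * sumTo q (suc b)) (suc a)
    ≡⟨ sumTo-*ʳ (suc a) (sumTo q (suc b)) p ⟩
  sumTo p (suc a) * sumTo q (suc b) ∎
  where
  open ≡-Reasoning
  diagonal-hit : ∀ {i j} → i ≤ a → j ≤ b →
                 sumTo (λ n → kronecker (i +ℕ j) n * (p i * q j)) (suc (a +ℕ b)) ≡ p i * q j
  diagonal-hit {i} {j} i≤a j≤b =
    trans (sumTo-supported (λ n → kronecker (i +ℕ j) n * (p i * q j)) (s≤s (ℕ.+-mono-≤ i≤a j≤b))
            (λ n _ n≢i+j → trans (cong (_* (p i * q j)) (kronecker-≢ (≢-sym n≢i+j))) (ℤ.*-zeroˡ (p i * q j))))
          (trans (cong (_* (p i * q j)) (kronecker-≡ {i +ℕ j} refl)) (ℤ.*-identityˡ (p i * q j)))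

-- Reversal

-- rev P ρ a s t unfolds to revₚ (ρ s t) (a s t).
revₚ : ℕ → Poly → Poly
revₚ n p k = if k ℕ.≤ᵇ n then p (n ∸ k) else 0ℤ

revₚ-≤ : ∀ n p {k} → k ≤ n → revₚ n p k ≡ p (n ∸ k)
revₚ-≤ n p {k} k≤n with k ℕ.≤ᵇ n | ℕ.≤⇒≤ᵇ k≤n
... | true | _ = refl

revₚ-> : ∀ n p {k} → n < k → revₚ n p k ≡ 0ℤ
revₚ-> n p {k} n<k with k ℕ.≤ᵇ n | ℕ.≤ᵇ⇒≤ k n
... | false | _    = refl
... | true  | k≤n = ⊥-elim (ℕ.<⇒≱ n<k (k≤n tt))

revₚ-0 : ∀ p → revₚ 0 p ≈ₚ const (p 0)
revₚ-0 p zero    = refl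
revₚ-0 p (suc k) = refl

revₚ-cong : ∀ n {p q} → p ≈ₚ q → revₚ n p ≈ₚ revₚ n q
revₚ-cong n p≈q k with k ℕ.≤ᵇ n
... | true  = p≈q (n ∸ k)
... | false = refl

DegLe-revₚ : ∀ n p → DegLe (revₚ n p) n
DegLe-revₚ n p k n<k = revₚ-> n p n<k

revₚ-involutive : ∀ {n p} → DegLe p n → revₚ n (revₚ n p) ≈ₚ p
revₚ-involutive {n} {p} p≤n k with k ℕ.≤? n
... | yes k≤n = trans (revₚ-≤ n (revₚ n p) k≤n)
                      (trans (revₚ-≤ n p (ℕ.m∸n≤m n k)) (cong p (ℕ.m∸[m∸n]≡n k≤n)))
... | no  k≰n = trans (revₚ-> n (revₚ n p) (ℕ.≰⇒> k≰n)) (sym (p≤n k (ℕ.≰⇒> k≰n)))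

sumTo-revₚ : ∀ n p → sumTo (revₚ n p) (suc n) ≡ sumTo p (suc n)
sumTo-revₚ n p = trans (sumTo-cong (suc n) (λ i i≤n → revₚ-≤ n p (ℕ.≤-pred i≤n))) (sym (sumTo-reverse n p))

revₚ-∑ : (L : List A) (G : A → Poly) (n : ℕ) →
         revₚ n (λ i → ∑[ x ∈ L ] G x i) ≈ₚ (λ k → ∑[ x ∈ L ] revₚ n (G x) k)
revₚ-∑ L G n k with k ℕ.≤? n
... | yes k≤n = trans (revₚ-≤ n (λ i → ∑[ x ∈ L ] G x i) k≤n) (∑-cong L (λ x _ → sym (revₚ-≤ n (G x) k≤n)))
... | no  k≰n = trans (revₚ-> n (λ i → ∑[ x ∈ L ] G x i) (ℕ.≰⇒> k≰n))
                      (sym (∑-zero L (λ x _ → revₚ-> n (G x) (ℕ.≰⇒> k≰n))))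

private
  ∸-+-∸ : ∀ {a b i j} → i ≤ a → j ≤ b → (a ∸ i) +ℕ (b ∸ j) ≡ (a +ℕ b) ∸ (i +ℕ j)
  ∸-+-∸ {a} {b} {i} {j} i≤a j≤b = begin
    (a ∸ i) +ℕ (b ∸ j)   ≡⟨ sym (ℕ.+-∸-assoc (a ∸ i) j≤b) ⟩
    (a ∸ i) +ℕ b ∸ j     ≡⟨ cong (_∸ j) (sym (ℕ.+-∸-comm b i≤a)) ⟩
    (a +ℕ b) ∸ i ∸ j     ≡⟨ ℕ.∸-+-assoc (a +ℕ b) i j ⟩
    (a +ℕ b) ∸ (i +ℕ j)  ∎
    where open ≡-Reasoning

revₚ-⋆ : ∀ {p q a b} → DegLe p a → DegLe q b → revₚ (a +ℕ b) (p ⋆ q) ≈ₚ (revₚ a p ⋆ revₚ b q)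
revₚ-⋆ {p} {q} {a} {b} p≤a q≤b k with k ℕ.≤? a +ℕ b
... | no  k≰a+b = trans (revₚ-> (a +ℕ b) (p ⋆ q) (ℕ.≰⇒> k≰a+b))
                        (sym (DegLe-⋆ (DegLe-revₚ a p) (DegLe-revₚ b q) k (ℕ.≰⇒> k≰a+b)))
... | yes k≤a+b = begin
  revₚ (a +ℕ b) (p ⋆ q) k
    ≡⟨ revₚ-≤ (a +ℕ b) (p ⋆ q) k≤a+b ⟩
  (p ⋆ q) (a +ℕ b ∸ k)
    ≡⟨ ⋆-rectangle p≤a q≤b (a +ℕ b ∸ k) ⟩
  rectangle p q a b (a +ℕ b ∸ k)
    ≡⟨ sumTo-cong (suc a) (λ i i≤a → sumTo-cong (suc b) (λ j j≤b → reflect (ℕ.≤-pred i≤a) (ℕ.≤-pred j≤b))) ⟩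
  sumTo (λ i → sumTo (λ j → kronecker ((a ∸ i) +ℕ (b ∸ j)) k * (revₚ a p (a ∸ i) * revₚ b q (b ∸ j)))
                     (suc b)) (suc a)
    ≡⟨ sym (trans (sumTo-reverse a _) (sumTo-cong (suc a) (λ i _ → sumTo-reverse b _))) ⟩
  rectangle (revₚ a p) (revₚ b q) a b k
    ≡⟨ sym (⋆-rectangle (DegLe-revₚ a p) (DegLe-revₚ b q) k) ⟩
  (revₚ a p ⋆ revₚ b q) k ∎
  where
  open ≡-Reasoning
  reflect : ∀ {i j} → i ≤ a → j ≤ b →
            kronecker (i +ℕ j) (a +ℕ b ∸ k) * (p i * q j)
            ≡ kronecker ((a ∸ i) +ℕ (b ∸ j)) k * (revₚ a p (a ∸ i) * revₚ b q (b ∸ j))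
  reflect {i} {j} i≤a j≤b = cong₂ _*_
    (kronecker-cong
      (λ i+j≡a+b∸k → trans (∸-+-∸ i≤a j≤b) (trans (cong (a +ℕ b ∸_) i+j≡a+b∸k) (ℕ.m∸[m∸n]≡n k≤a+b)))
      (λ a∸i+b∸j≡k → trans (sym (ℕ.m∸[m∸n]≡n (ℕ.+-mono-≤ i≤a j≤b)))
                           (cong (a +ℕ b ∸_) (trans (sym (∸-+-∸ i≤a j≤b)) a∸i+b∸j≡k))))
    (sym (cong₂ _*_ (trans (revₚ-≤ a p (ℕ.m∸n≤m a i)) (cong p (ℕ.m∸[m∸n]≡n i≤a)))
                    (trans (revₚ-≤ b q (ℕ.m∸n≤m b j)) (cong q (ℕ.m∸[m∸n]≡n j≤b)))))

revₚ-suc : ∀ {p r} → DegLe p r → revₚ (suc r) p ≈ₚ (X ⋆ revₚ r p)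
revₚ-suc {p} {r} p≤r zero    =
  trans (p≤r (suc r) ℕ.≤-refl) (sym (trans (⋆-coeff₀ X (revₚ r p)) (ℤ.*-zeroˡ (revₚ r p 0))))
revₚ-suc {p} {r} p≤r (suc k) with k ℕ.≤? r
... | yes k≤r = trans (revₚ-≤ (suc r) p (s≤s k≤r)) (sym (trans (X-⋆ (revₚ r p) k) (revₚ-≤ r p k≤r)))
... | no  k≰r = trans (revₚ-> (suc r) p (s≤s (ℕ.≰⇒> k≰r)))
                      (sym (trans (X-⋆ (revₚ r p) k) (revₚ-> r p (ℕ.≰⇒> k≰r))))

revₚ-x-1 : revₚ 1 x-1 ≈ₚ (-1ℤ · x-1)
revₚ-x-1 zero          = refl
revₚ-x-1 (suc zero)    = refl
revₚ-x-1 (suc (suc k)) = refl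

X-⋆-revₚ-x-1-⋆ : ∀ {q n} → 0 < n → DegLt q n → (X ⋆ revₚ n (x-1 ⋆ q)) ≈ₚ (-1ℤ · (x-1 ⋆ revₚ n q))
X-⋆-revₚ-x-1-⋆ {q} {suc r} _ q≤r = begin
  X ⋆ revₚ (suc r) (x-1 ⋆ q)          ≈⟨ ⋆-congˡ X (revₚ-⋆ DegLe-x-1 q≤r) ⟩
  X ⋆ (revₚ 1 x-1 ⋆ R)                ≈⟨ ⋆-congˡ X (⋆-congʳ R revₚ-x-1) ⟩
  X ⋆ ((-1ℤ · x-1) ⋆ R)               ≈⟨ ⋆-congˡ X (·-⋆ -1ℤ x-1 R) ⟩
  X ⋆ (-1ℤ · (x-1 ⋆ R))               ≈⟨ ⋆-· -1ℤ X (x-1 ⋆ R) ⟩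
  -1ℤ · (X ⋆ (x-1 ⋆ R))               ≈⟨ (λ k → cong (-1ℤ *_) (x-1-⋆-commutes k)) ⟩
  -1ℤ · (x-1 ⋆ (X ⋆ R))               ≈⟨ (λ k → cong (-1ℤ *_) (⋆-congˡ x-1 (revₚ-suc q≤r) k)) ⟨
  -1ℤ · (x-1 ⋆ revₚ (suc r) q)        ∎
  where
  open ≈ₚ-Reasoning
  R : Poly
  R = revₚ r q
  x-1-⋆-commutes : (X ⋆ (x-1 ⋆ R)) ≈ₚ (x-1 ⋆ (X ⋆ R))
  x-1-⋆-commutes k = trans (sym (⋆-assoc X x-1 R k))
                     (trans (⋆-congʳ R (⋆-comm X x-1) k) (⋆-assoc x-1 X R k))

module Incidence {c ℓ} (P : LocallyFinitePoset c ℓ) where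

  open LocallyFinitePoset P public using ()
    renaming (Carrier to Pt; _≤P_ to _≼_; _<P_ to _≺_; interval to [_,_]; interval-unique to [,]-unique)

  open IsPartialOrder (isPartialOrder P) public using ()
    renaming (refl to ≼-refl; trans to ≼-trans; antisym to ≼-antisym)

  ∈[,]⁺ : ∀ {s t w} → s ≼ w → w ≼ t → w ∈ [ s , t ]
  ∈[,]⁺ = interval-complete P _ _ _

  ∈[,]⁻ : ∀ {s t w} → w ∈ [ s , t ] → s ≼ w × w ≼ t
  ∈[,]⁻ = interval-sound P _ _ _

  ≼-≺-asym : ∀ {s t} → s ≼ t → t ≺ s → ⊥
  ≼-≺-asym s≼t (t≼s , t≢s) = t≢s (≼-antisym t≼s s≼t)

  -- Equality of points need not be decidable, but the goal is an equation in ℤ, which is ¬¬-stable.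
  ≼-caseℤ : ∀ {s t} {x y : ℤ} → s ≼ t → (s ≡ t → x ≡ y) → (s ≺ t → x ≡ y) → x ≡ y
  ≼-caseℤ {x = x} {y} s≼t on-diagonal strict =
    decidable-stable (x ℤ.≟ y) (λ x≢y → x≢y (strict (s≼t , λ s≡t → x≢y (on-diagonal s≡t))))

  ∑-interval-top : ∀ {s t} (F : Pt → ℤ) → s ≼ t → (∀ w → s ≼ w → w ≺ t → F w ≡ 0ℤ) →
                   ∑ [ s , t ] F ≡ F t
  ∑-interval-top F s≼t F≡0 = ∑-supported F ([,]-unique _ _) (∈[,]⁺ s≼t ≼-refl)
    (λ w w∈ w≢t → let s≼w , w≼t = ∈[,]⁻ w∈ in F≡0 w s≼w (w≼t , w≢t))

  ∑-interval-bottom : ∀ {s t} (F : Pt → ℤ) → s ≼ t → (∀ w → s ≺ w → w ≼ t → F w ≡ 0ℤ) →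
                      ∑ [ s , t ] F ≡ F s
  ∑-interval-bottom F s≼t F≡0 = ∑-supported F ([,]-unique _ _) (∈[,]⁺ ≼-refl s≼t)
    (λ w w∈ w≢s → let s≼w , w≼t = ∈[,]⁻ w∈ in F≡0 w (s≼w , ≢-sym w≢s) w≼t)

  ∑-interval-ends : ∀ {s t} (F : Pt → ℤ) → s ≺ t → (∀ w → s ≺ w → w ≺ t → F w ≡ 0ℤ) →
                    ∑ [ s , t ] F ≡ F s + F t
  ∑-interval-ends F (s≼t , s≢t) F≡0 =
    ∑-supported₂ F ([,]-unique _ _) (∈[,]⁺ ≼-refl s≼t) (∈[,]⁺ s≼t ≼-refl) s≢t
    (λ w w∈ w≢s w≢t → let s≼w , w≼t = ∈[,]⁻ w∈ in F≡0 w (s≼w , ≢-sym w≢s) (w≼t , w≢t))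

  infix 4 _≈_
  _≈_ : Inc P → Inc P → Set (c ⊔ ℓ)
  _≈_ = _≈ᵢ_ P

  infixl 7 _∙_
  _∙_ : Inc P → Inc P → Inc P
  _∙_ = _⊛_ P

  ≈ᵢ-setoid : Setoid c (c ⊔ ℓ)
  ≈ᵢ-setoid = record
    { Carrier       = Inc P
    ; _≈_           = _≈_
    ; isEquivalence = record
      { refl  = λ s t _ k → refl
      ; sym   = λ a≈b s t s≼t k → sym (a≈b s t s≼t k)
      ; trans = λ a≈b b≈d s t s≼t k → trans (a≈b s t s≼t k) (b≈d s t s≼t k)
      }
    }

  module ≈ᵢ-Reasoning = SetoidReasoning ≈ᵢ-setoid
  open Setoid ≈ᵢ-setoid public using () renaming (sym to ≈ᵢ-sym)

  ∙-cong : ∀ {a a′ b b′} → a ≈ a′ → b ≈ b′ → a ∙ b ≈ a′ ∙ b′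
  ∙-cong a≈a′ b≈b′ s t _ k = ∑-cong [ s , t ] (λ w w∈ → let s≼w , w≼t = ∈[,]⁻ w∈ in
    ⋆-cong (a≈a′ s w s≼w) (b≈b′ w t w≼t) k)

  ∙-congˡ : ∀ a {b b′} → b ≈ b′ → a ∙ b ≈ a ∙ b′
  ∙-congˡ a = ∙-cong {a = a} (λ _ _ _ _ → refl)

  ∙-congʳ : ∀ d {a a′} → a ≈ a′ → a ∙ d ≈ a′ ∙ d
  ∙-congʳ d a≈a′ = ∙-cong {b = d} a≈a′ (λ _ _ _ _ → refl)

  ∙-assoc : ∀ a b d → (a ∙ b) ∙ d ≈ a ∙ (b ∙ d)
  ∙-assoc a b d s t _ k = begin
    ∑[ w ∈ [ s , t ] ] ((a ∙ b) s w ⋆ d w t) k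
      ≡⟨ ∑-cong [ s , t ] (λ w _ → trans (∑-⋆ [ s , w ] (λ v → a s v ⋆ b v w) (d w t) k)
                                         (∑-cong [ s , w ] (λ v _ → ⋆-assoc (a s v) (b v w) (d w t) k))) ⟩
    ∑[ w ∈ [ s , t ] ] ∑[ v ∈ [ s , w ] ] (a s v ⋆ (b v w ⋆ d w t)) k
      ≡⟨ ∑-fubini ([,]-unique s t) ([,]-unique s t) ([,]-unique s) (λ v → [,]-unique v t) to from
                  (λ w v → (a s v ⋆ (b v w ⋆ d w t)) k) ⟩
    ∑[ v ∈ [ s , t ] ] ∑[ w ∈ [ v , t ] ] (a s v ⋆ (b v w ⋆ d w t)) k
      ≡⟨ ∑-cong [ s , t ] (λ v _ → sym (⋆-∑ [ v , t ] (λ w → b v w ⋆ d w t) (a s v) k)) ⟩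
    ∑[ v ∈ [ s , t ] ] (a s v ⋆ (b ∙ d) v t) k ∎
    where
    open ≡-Reasoning
    to : ∀ {w v} → w ∈ [ s , t ] → v ∈ [ s , w ] → v ∈ [ s , t ] × w ∈ [ v , t ]
    to w∈ v∈ = let s≼w , w≼t = ∈[,]⁻ w∈ ; s≼v , v≼w = ∈[,]⁻ v∈ in
               ∈[,]⁺ s≼v (≼-trans v≼w w≼t) , ∈[,]⁺ v≼w w≼t
    from : ∀ {w v} → v ∈ [ s , t ] → w ∈ [ v , t ] → w ∈ [ s , t ] × v ∈ [ s , w ]
    from v∈ w∈ = let s≼v , v≼t = ∈[,]⁻ v∈ ; v≼w , w≼t = ∈[,]⁻ w∈ in
                 ∈[,]⁺ (≼-trans s≼v v≼w) w≼t , ∈[,]⁺ s≼v v≼w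

  infixl 7 _·ᵢ_ _⊙_
  infixl 6 _⊞_

  _·ᵢ_ : ℤ → Inc P → Inc P
  (u ·ᵢ a) s t = u · a s t

  _⊙_ : Poly → Inc P → Inc P
  (p ⊙ a) s t = p ⋆ a s t

  _⊞_ : Inc P → Inc P → Inc P
  (a ⊞ b) s t = a s t ⊕ b s t

  ∙-distribʳ-⊞ : ∀ a b d → (a ⊞ b) ∙ d ≈ a ∙ d ⊞ b ∙ d
  ∙-distribʳ-⊞ a b d s t _ k =
    trans (∑-cong [ s , t ] (λ w _ → ⋆-distribʳ-⊕ (a s w) (b s w) (d w t) k))
          (∑-+ [ s , t ] (λ w → (a s w ⋆ d w t) k) (λ w → (b s w ⋆ d w t) k))

  ∙-distribˡ-⊞ : ∀ a b d → d ∙ (a ⊞ b) ≈ d ∙ a ⊞ d ∙ b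
  ∙-distribˡ-⊞ a b d s t _ k =
    trans (∑-cong [ s , t ] (λ w _ → ⋆-distribˡ-⊕ (d s w) (a w t) (b w t) k))
          (∑-+ [ s , t ] (λ w → (d s w ⋆ a w t) k) (λ w → (d s w ⋆ b w t) k))

  ⊙-∙ : ∀ p a b → (p ⊙ a) ∙ b ≈ p ⊙ (a ∙ b)
  ⊙-∙ p a b s t _ k =
    trans (∑-cong [ s , t ] (λ w _ → ⋆-assoc p (a s w) (b w t) k))
          (sym (⋆-∑ [ s , t ] (λ w → a s w ⋆ b w t) p k))

  ∙-⊙ : ∀ p a b → a ∙ (p ⊙ b) ≈ p ⊙ (a ∙ b)
  ∙-⊙ p a b s t _ k =
    trans (∑-cong [ s , t ] (λ w _ → begin
             (a s w ⋆ (p ⋆ b w t)) k   ≡⟨ ⋆-assoc (a s w) p (b w t) k ⟨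
             ((a s w ⋆ p) ⋆ b w t) k   ≡⟨ ⋆-congʳ (b w t) (⋆-comm (a s w) p) k ⟩
             ((p ⋆ a s w) ⋆ b w t) k   ≡⟨ ⋆-assoc p (a s w) (b w t) k ⟩
             (p ⋆ (a s w ⋆ b w t)) k   ∎))
          (sym (⋆-∑ [ s , t ] (λ w → a s w ⋆ b w t) p k))
    where open ≡-Reasoning

  ⊞-cong : ∀ {a a′ b b′} → a ≈ a′ → b ≈ b′ → a ⊞ b ≈ a′ ⊞ b′
  ⊞-cong a≈a′ b≈b′ s t s≼t k = cong₂ _+_ (a≈a′ s t s≼t k) (b≈b′ s t s≼t k)

  1·ᵢ : ∀ a → 1ℤ ·ᵢ a ≈ a
  1·ᵢ a s t _ k = ℤ.*-identityˡ (a s t k)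

  ⊞-x-1-⊙-cancel : ∀ {a b d} → x-1 ⊙ a ⊞ d ≈ x-1 ⊙ b ⊞ d → a ≈ b
  ⊞-x-1-⊙-cancel {a} {b} {d} eq s t s≼t =
    x-1-⋆-cancel (λ k → +-cancelʳ (d s t k) _ _ (eq s t s≼t k))

  δ-∙ : ∀ {u a} → IsScalarδ P u a → ∀ b → a ∙ b ≈ u ·ᵢ b
  δ-∙ {u} {a} (a-diag , a-off) b s t s≼t k =
    trans (∑-interval-bottom (λ w → (a s w ⋆ b w t) k) s≼t
            (λ w s≺w _ → trans (⋆-congʳ (b w t) (a-off s w s≺w) k)
                               (trans (const-⋆ 0ℤ (b w t) k) (ℤ.*-zeroˡ (b w t k)))))
          (trans (⋆-congʳ (b s t) (a-diag s) k) (const-⋆ u (b s t) k))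

  ∙-δ : ∀ {u a} → IsScalarδ P u a → ∀ b → b ∙ a ≈ u ·ᵢ b
  ∙-δ {u} {a} (a-diag , a-off) b s t s≼t k =
    trans (∑-interval-top (λ w → (b s w ⋆ a w t) k) s≼t
            (λ w _ w≺t → trans (⋆-congˡ (b s w) (a-off w t w≺t) k)
                               (trans (⋆-const 0ℤ (b s w) k) (ℤ.*-zeroˡ (b s w k)))))
          (trans (⋆-congˡ (b s t) (a-diag t) k) (⋆-const u (b s t) k))

  IsScalarδ-resp : ∀ {u a b} → a ≈ b → IsScalarδ P u a → IsScalarδ P u b
  IsScalarδ-resp a≈b (a-diag , a-off) =
    (λ s k → trans (sym (a≈b s s ≼-refl k)) (a-diag s k)) ,
    (λ s t s≺t k → trans (sym (a≈b s t (proj₁ s≺t) k)) (a-off s t s≺t k))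

  inverse-unique : ∀ {u} a b d .{{_ : ℤ.NonZero u}} → IsScalarδ P u (a ∙ b) → IsScalarδ P u (b ∙ d) → a ≈ d
  inverse-unique {u} a b d ab≈uδ bd≈uδ s t s≼t k = ℤ.*-cancelˡ-≡ u (a s t k) (d s t k) (begin
    u * a s t k            ≡⟨ ∙-δ bd≈uδ a s t s≼t k ⟨
    (a ∙ (b ∙ d)) s t k    ≡⟨ ∙-assoc a b d s t s≼t k ⟨
    ((a ∙ b) ∙ d) s t k    ≡⟨ δ-∙ ab≈uδ d s t s≼t k ⟩
    u * d s t k            ∎)
    where open ≡-Reasoning

  ∙-coeff₀ : ∀ a b s t → (a ∙ b) s t 0 ≡ ∑[ w ∈ [ s , t ] ] (a s w 0 * b w t 0)
  ∙-coeff₀ a b s t = ∑-cong [ s , t ] (λ w _ → ⋆-coeff₀ (a s w) (b w t))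

  ∙-coeff₀-top : ∀ {s t} a b → s ≼ t → b t t 0 ≡ 1ℤ → (∀ w → s ≼ w → w ≺ t → b w t 0 ≡ 0ℤ) →
                 (a ∙ b) s t 0 ≡ a s t 0
  ∙-coeff₀-top {s} {t} a b s≼t btt≡1 b≡0 = begin
    (a ∙ b) s t 0                            ≡⟨ ∙-coeff₀ a b s t ⟩
    ∑[ w ∈ [ s , t ] ] (a s w 0 * b w t 0)   ≡⟨ ∑-interval-top _ s≼t (λ w s≼w w≺t →
                                                  trans (cong (a s w 0 *_) (b≡0 w s≼w w≺t)) (ℤ.*-zeroʳ (a s w 0))) ⟩
    a s t 0 * b t t 0                        ≡⟨ trans (cong (a s t 0 *_) btt≡1) (ℤ.*-identityʳ (a s t 0)) ⟩
    a s t 0                                  ∎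
    where open ≡-Reasoning

  ∙-coeff₀-bottom : ∀ {s t} a b → s ≼ t → a s s 0 ≡ 1ℤ → (∀ w → s ≺ w → w ≼ t → a s w 0 ≡ 0ℤ) →
                    (a ∙ b) s t 0 ≡ b s t 0
  ∙-coeff₀-bottom {s} {t} a b s≼t ass≡1 a≡0 = begin
    (a ∙ b) s t 0                            ≡⟨ ∙-coeff₀ a b s t ⟩
    ∑[ w ∈ [ s , t ] ] (a s w 0 * b w t 0)   ≡⟨ ∑-interval-bottom _ s≼t (λ w s≺w w≼t →
                                                  trans (cong (_* b w t 0) (a≡0 w s≺w w≼t)) (ℤ.*-zeroˡ (b w t 0))) ⟩
    a s s 0 * b s t 0                        ≡⟨ trans (cong (_* b s t 0) ass≡1) (ℤ.*-identityˡ (b s t 0)) ⟩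
    b s t 0                                  ∎
    where open ≡-Reasoning

module Ranked {c ℓ} (P : LocallyFinitePoset c ℓ) (ρ : Carrier P → Carrier P → ℕ) (ρ-rank : IsWeakRank P ρ) where

  open Incidence P
  open IsWeakRank ρ-rank

  ρ-diag : ∀ s → ρ s s ≡ 0
  ρ-diag s = ℕ.+-cancelˡ-≡ (ρ s s) (ρ s s) 0
    (trans (sym (additive s s s ≼-refl ≼-refl)) (sym (ℕ.+-identityʳ (ρ s s))))

  ρ-strict : ∀ {s w t} → s ≼ w → w ≺ t → ρ s w < ρ s t
  ρ-strict {s} {w} {t} s≼w w≺t =
    subst (ρ s w <_) (sym (additive s w t s≼w (proj₁ w≺t))) (ℕ.m<m+n (ρ s w) (pos w t w≺t))

  rank-induction : ∀ {q} (Q : Pt → Pt → Set q) →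
                   (∀ {s t} → s ≼ t → (∀ {w} → s ≼ w → w ≺ t → Q s w) → Q s t) →
                   ∀ {s t} → s ≼ t → Q s t
  rank-induction Q step {s} {t} s≼t = go (suc (ρ s t)) s≼t ℕ.≤-refl
    where
    go : ∀ n {s t} → s ≼ t → ρ s t < n → Q s t
    go (suc n) s≼t ρ<1+n =
      step s≼t (λ s≼w w≺t → go n s≼w (ℕ.<-≤-trans (ρ-strict s≼w w≺t) (ℕ.≤-pred ρ<1+n)))

  -- (a ʳ) s t 0 reduces to a s t (ρ s t).
  infix 10 _ʳ
  _ʳ : Inc P → Inc P
  a ʳ = rev P ρ a

  ʳ-InIρ : ∀ a → InIρ P ρ (a ʳ)
  ʳ-InIρ a s t _ = DegLe-revₚ (ρ s t) (a s t)

  ʳ-involutive : ∀ {a} → InIρ P ρ a → a ʳ ʳ ≈ a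
  ʳ-involutive a∈Iρ s t s≼t = revₚ-involutive (a∈Iρ s t s≼t)

  ʳ-∙ : ∀ {a b} → InIρ P ρ a → InIρ P ρ b → (a ∙ b) ʳ ≈ a ʳ ∙ b ʳ
  ʳ-∙ {a} {b} a∈Iρ b∈Iρ s t _ k =
    trans (revₚ-∑ [ s , t ] (λ w → a s w ⋆ b w t) (ρ s t) k)
          (∑-cong [ s , t ] (λ w w∈ → let s≼w , w≼t = ∈[,]⁻ w∈ in
             trans (cong (λ n → revₚ n (a s w ⋆ b w t) k) (additive s w t s≼w w≼t))
                   (revₚ-⋆ (a∈Iρ s w s≼w) (b∈Iρ w t w≼t) k)))

  ʳ-diag : ∀ a s {u} → a s s ≈ₚ const u → (a ʳ) s s ≈ₚ const u
  ʳ-diag a s ass≈u k =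
    trans (cong (λ n → revₚ n (a s s) k) (ρ-diag s)) (trans (revₚ-0 (a s s) k) (cong (λ v → const v k) (ass≈u 0)))

  IsScalarδ-ʳ : ∀ {u a} → IsScalarδ P u a → IsScalarδ P u (a ʳ)
  IsScalarδ-ʳ {a = a} (a-diag , a-off) =
    (λ s → ʳ-diag a s (a-diag s)) ,
    (λ s t s≺t k → trans (revₚ-cong (ρ s t) (λ i → trans (a-off s t s≺t i) (const0 i)) k)
                         (trans (revₚ-zero (ρ s t) k) (sym (const0 k))))
    where
    revₚ-zero : ∀ n → revₚ n (λ _ → 0ℤ) ≈ₚ (λ _ → 0ℤ)
    revₚ-zero n k with k ℕ.≤ᵇ n
    ... | true  = refl
    ... | false = refl

  palindromic-HasDeg : ∀ {a s t} → a ʳ ≈ a → s ≼ t → a s t (ρ s t) ≢ 0ℤ → HasDeg (a s t) (ρ s t)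
  palindromic-HasDeg {a} {s} {t} aʳ≈a s≼t top≢0 =
    top≢0 , λ k ρ<k → trans (sym (aʳ≈a s t s≼t k)) (revₚ-> (ρ s t) (a s t) ρ<k)

x+x≡0⇒x≡0 : ∀ x → x + x ≡ 0ℤ → x ≡ 0ℤ
x+x≡0⇒x≡0 (ℤ.+ zero)  _ = refl
x+x≡0⇒x≡0 ℤ.+[1+ n ] ()
x+x≡0⇒x≡0 ℤ.-[1+ n ] ()

module Kernel {c ℓ} (P : LocallyFinitePoset c ℓ)
              (ρ : Carrier P → Carrier P → ℕ) (ρ-rank : IsWeakRank P ρ)
              (κ : Inc P) (κ-kernel : IsKernel P ρ κ)
              (κ̄ : Inc P) (κ̄-reduced : IsReducedKernel P κ κ̄) where

  open Incidence P
  open Ranked P ρ ρ-rank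
  open IsWeakRank ρ-rank
  open IsKernel κ-kernel

  κ̄-diag : ∀ s → κ̄ s s ≈ₚ const -1ℤ
  κ̄-diag = proj₁ κ̄-reduced

  κ≈x-1⋆κ̄ : ∀ s t → s ≺ t → κ s t ≈ₚ (x-1 ⋆ κ̄ s t)
  κ≈x-1⋆κ̄ = proj₂ κ̄-reduced

  κ-at-1 : Pt → Pt → ℤ
  κ-at-1 s t = sumTo (κ s t) (suc (ρ s t))

  κ-at-1-diag : ∀ s → κ-at-1 s s ≡ 1ℤ
  κ-at-1-diag s = trans (cong (λ n → sumTo (κ s s) (suc n)) (ρ-diag s)) (trans (ℤ.+-identityˡ (κ s s 0)) (diag s 0))

  -- Evaluating κ κʳ = δ at x = 1, where κʳ(1) = κ(1).
  κ-at-1-squared : ∀ {s t} → s ≺ t → ∑[ w ∈ [ s , t ] ] (κ-at-1 s w * κ-at-1 w t) ≡ 0ℤ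
  κ-at-1-squared {s} {t} s≺t = begin
    ∑[ w ∈ [ s , t ] ] (κ-at-1 s w * κ-at-1 w t)
      ≡⟨ ∑-cong [ s , t ] (λ w w∈ → sym (at-1-⋆ (∈[,]⁻ w∈))) ⟩
    ∑[ w ∈ [ s , t ] ] sumTo (κ s w ⋆ (κ ʳ) w t) (suc (ρ s t))
      ≡⟨ sumTo-∑ [ s , t ] (λ w → κ s w ⋆ (κ ʳ) w t) (suc (ρ s t)) ⟨
    sumTo ((κ ∙ κ ʳ) s t) (suc (ρ s t))
      ≡⟨ sumTo-zero (suc (ρ s t)) (λ k _ → trans (proj₂ invRight s t s≺t k) (const0 k)) ⟩
    0ℤ ∎
    where
    open ≡-Reasoning
    at-1-⋆ : ∀ {w} → s ≼ w × w ≼ t → sumTo (κ s w ⋆ (κ ʳ) w t) (suc (ρ s t)) ≡ κ-at-1 s w * κ-at-1 w t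
    at-1-⋆ {w} (s≼w , w≼t) =
      trans (cong (λ n → sumTo (κ s w ⋆ (κ ʳ) w t) (suc n)) (additive s w t s≼w w≼t))
      (trans (sumTo-⋆ (inIρ s w s≼w) (ʳ-InIρ κ w t w≼t))
             (cong (κ-at-1 s w *_) (sumTo-revₚ (ρ w t) (κ w t))))

  κ-at-1-strict : ∀ {s t} → s ≺ t → κ-at-1 s t ≡ 0ℤ
  κ-at-1-strict s≺t = rank-induction (λ s t → s ≺ t → κ-at-1 s t ≡ 0ℤ) step (proj₁ s≺t) s≺t
    where
    step : ∀ {s t} → s ≼ t → (∀ {w} → s ≼ w → w ≺ t → s ≺ w → κ-at-1 s w ≡ 0ℤ) →
           s ≺ t → κ-at-1 s t ≡ 0ℤ
    step {s} {t} _ IH s≺t = x+x≡0⇒x≡0 (κ-at-1 s t) (begin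
      κ-at-1 s t + κ-at-1 s t
        ≡⟨ cong₂ _+_ (sym (trans (cong (_* κ-at-1 s t) (κ-at-1-diag s)) (ℤ.*-identityˡ _)))
                     (sym (trans (cong (κ-at-1 s t *_) (κ-at-1-diag t)) (ℤ.*-identityʳ _))) ⟩
      κ-at-1 s s * κ-at-1 s t + κ-at-1 s t * κ-at-1 t t
        ≡⟨ ∑-interval-ends (λ w → κ-at-1 s w * κ-at-1 w t) s≺t
             (λ w s≺w w≺t → trans (cong (_* κ-at-1 w t) (IH (proj₁ s≺w) w≺t s≺w)) (ℤ.*-zeroˡ (κ-at-1 w t))) ⟨
      ∑[ w ∈ [ s , t ] ] (κ-at-1 s w * κ-at-1 w t)
        ≡⟨ κ-at-1-squared s≺t ⟩
      0ℤ ∎)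
      where open ≡-Reasoning

  reduced-DegLt : ∀ {s t} → s ≺ t → DegLt (κ̄ s t) (ρ s t)
  reduced-DegLt {s} {t} s≺t k ρ≤k = ℤ.neg-injective (begin
    - κ̄ s t k
      ≡⟨ x-1-⋆-telescopes (κ̄ s t) k ⟨
    sumTo (x-1 ⋆ κ̄ s t) (suc k)
      ≡⟨ sumTo-cong (suc k) (λ i _ → κ≈x-1⋆κ̄ s t s≺t i) ⟨
    sumTo (κ s t) (suc k)
      ≡⟨ sumTo-extend (suc (ρ s t)) (suc k) (κ s t) (s≤s ρ≤k) (λ i ρ<i → inIρ s t (proj₁ s≺t) i ρ<i) ⟩
    κ-at-1 s t
      ≡⟨ κ-at-1-strict s≺t ⟩
    0ℤ ∎)
    where open ≡-Reasoning

  reduced-InIρ : InIρ P ρ κ̄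
  reduced-InIρ s t s≼t k ρ<k = ≼-caseℤ s≼t
    (λ { refl → on-diagonal k ρ<k })
    (λ s≺t → reduced-DegLt s≺t k (ℕ.<⇒≤ ρ<k))
    where
    on-diagonal : ∀ k → ρ s s < k → κ̄ s s k ≡ 0ℤ
    on-diagonal (suc k) _ = κ̄-diag s (suc k)

  kernel-decomposition : ∀ {M} → IsScalarδ P 1ℤ M → κ ≈ x-1 ⊙ κ̄ ⊞ X ⊙ M
  kernel-decomposition {M} (M-diag , M-off) s t s≼t k = ≼-caseℤ s≼t
    (λ { refl → trans (diag s k) (sym (trans (cong₂ _+_ (⋆-congˡ x-1 (κ̄-diag s) k)
                                                        (⋆-congˡ X (M-diag s) k))
                                             (x-1-⋆-const-1⊕X k))) })
    (λ s≺t → sym (trans (cong ((x-1 ⋆ κ̄ s t) k +_)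
                             (trans (⋆-congˡ X (M-off s t s≺t) k) (trans (⋆-const 0ℤ X k) (ℤ.*-zeroˡ (X k)))))
                       (trans (ℤ.+-identityʳ _) (sym (κ≈x-1⋆κ̄ s t s≺t k)))))

  -- On the diagonal this is -(x - 1) + x = 1; on a strict interval, reversing κ = (x - 1) κ̄
  -- gives x κʳ = -(x - 1) κ̄ʳ.
  reversed-decomposition : IsScalarδ P 1ℤ (x-1 ⊙ κ̄ ʳ ⊞ X ⊙ κ ʳ)
  reversed-decomposition = on-diagonal , off-diagonal
    where
    on-diagonal : ∀ s → (x-1 ⊙ κ̄ ʳ ⊞ X ⊙ κ ʳ) s s ≈ₚ const 1ℤ
    on-diagonal s k = trans (cong₂ _+_ (⋆-congˡ x-1 (ʳ-diag κ̄ s (κ̄-diag s)) k) (⋆-congˡ X (ʳ-diag κ s (diag s)) k))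
                            (x-1-⋆-const-1⊕X k)
    off-diagonal : ∀ s t → s ≺ t → (x-1 ⊙ κ̄ ʳ ⊞ X ⊙ κ ʳ) s t ≈ₚ const 0ℤ
    off-diagonal s t s≺t k = begin
      (x-1 ⋆ (κ̄ ʳ) s t) k + (X ⋆ (κ ʳ) s t) k
        ≡⟨ cong ((x-1 ⋆ (κ̄ ʳ) s t) k +_) (⋆-congˡ X (revₚ-cong (ρ s t) (κ≈x-1⋆κ̄ s t s≺t)) k) ⟩
      (x-1 ⋆ (κ̄ ʳ) s t) k + (X ⋆ revₚ (ρ s t) (x-1 ⋆ κ̄ s t)) k
        ≡⟨ cong ((x-1 ⋆ (κ̄ ʳ) s t) k +_) (X-⋆-revₚ-x-1-⋆ (pos s t s≺t) (reduced-DegLt s≺t) k) ⟩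
      (x-1 ⋆ (κ̄ ʳ) s t) k + -1ℤ * (x-1 ⋆ (κ̄ ʳ) s t) k
        ≡⟨ x+-1*x≡0 ((x-1 ⋆ (κ̄ ʳ) s t) k) ⟩
      0ℤ
        ≡⟨ const0 k ⟨
      const 0ℤ k ∎
      where
      open ≡-Reasoning
      x+-1*x≡0 : ∀ x → x + -1ℤ * x ≡ 0ℤ
      x+-1*x≡0 = solve-∀

  reduced-ʳ-∙ : κ̄ ʳ ∙ κ ≈ κ̄
  reduced-ʳ-∙ = ⊞-x-1-⊙-cancel (begin
    x-1 ⊙ (κ̄ ʳ ∙ κ) ⊞ X ⊙ (κ ʳ ∙ κ)   ≈⟨ ⊞-cong (⊙-∙ x-1 (κ̄ ʳ) κ) (⊙-∙ X (κ ʳ) κ) ⟨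
    x-1 ⊙ κ̄ ʳ ∙ κ ⊞ X ⊙ κ ʳ ∙ κ       ≈⟨ ∙-distribʳ-⊞ (x-1 ⊙ κ̄ ʳ) (X ⊙ κ ʳ) κ ⟨
    (x-1 ⊙ κ̄ ʳ ⊞ X ⊙ κ ʳ) ∙ κ         ≈⟨ δ-∙ reversed-decomposition κ ⟩
    1ℤ ·ᵢ κ                           ≈⟨ 1·ᵢ κ ⟩
    κ                                 ≈⟨ kernel-decomposition invLeft ⟩
    x-1 ⊙ κ̄ ⊞ X ⊙ (κ ʳ ∙ κ)           ∎)
    where open ≈ᵢ-Reasoning

  ∙-reduced-ʳ : κ ∙ κ̄ ʳ ≈ κ̄
  ∙-reduced-ʳ = ⊞-x-1-⊙-cancel (begin
    x-1 ⊙ (κ ∙ κ̄ ʳ) ⊞ X ⊙ (κ ∙ κ ʳ)   ≈⟨ ⊞-cong (∙-⊙ x-1 κ (κ̄ ʳ)) (∙-⊙ X κ (κ ʳ)) ⟨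
    κ ∙ (x-1 ⊙ κ̄ ʳ) ⊞ κ ∙ (X ⊙ κ ʳ)   ≈⟨ ∙-distribˡ-⊞ (x-1 ⊙ κ̄ ʳ) (X ⊙ κ ʳ) κ ⟨
    κ ∙ (x-1 ⊙ κ̄ ʳ ⊞ X ⊙ κ ʳ)         ≈⟨ ∙-δ reversed-decomposition κ ⟩
    1ℤ ·ᵢ κ                           ≈⟨ 1·ᵢ κ ⟩
    κ                                 ≈⟨ kernel-decomposition invRight ⟩
    x-1 ⊙ κ̄ ⊞ X ⊙ (κ ∙ κ ʳ)           ∎)
    where open ≈ᵢ-Reasoning

module Chow {c ℓ} (P : LocallyFinitePoset c ℓ)
            (ρ : Carrier P → Carrier P → ℕ) (ρ-rank : IsWeakRank P ρ)
            (κ : Inc P) (κ-kernel : IsKernel P ρ κ)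
            (κ̄ : Inc P) (κ̄-reduced : IsReducedKernel P κ κ̄)
            (H : Inc P) (H-chow : IsChowFunction P κ̄ H) where

  open Incidence P
  open Ranked P ρ ρ-rank
  open IsWeakRank ρ-rank
  open IsKernel κ-kernel
  open Kernel P ρ ρ-rank κ κ-kernel κ̄ κ̄-reduced
  private
    H∙κ̄≈-δ : IsScalarδ P -1ℤ (H ∙ κ̄)
    H∙κ̄≈-δ = proj₁ H-chow
    κ̄∙H≈-δ : IsScalarδ P -1ℤ (κ̄ ∙ H)
    κ̄∙H≈-δ = proj₂ H-chow

  chow-diag : ∀ s → H s s ≈ₚ const 1ℤ
  chow-diag s k = ℤ.*-cancelˡ-≡ -1ℤ (H s s k) (const 1ℤ k) (begin
    -1ℤ * H s s k                     ≡⟨ ⋆-const -1ℤ (H s s) k ⟨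
    (H s s ⋆ const -1ℤ) k             ≡⟨ ⋆-congˡ (H s s) (κ̄-diag s) k ⟨
    (H s s ⋆ κ̄ s s) k                 ≡⟨ ∑-interval-top (λ w → (H s w ⋆ κ̄ w s) k) ≼-refl
                                           (λ w s≼w w≺s → ⊥-elim (≼-≺-asym s≼w w≺s)) ⟨
    (H ∙ κ̄) s s k                     ≡⟨ proj₁ H∙κ̄≈-δ s k ⟩
    const -1ℤ k                       ≡⟨ const-1 k ⟩
    -1ℤ * const 1ℤ k                  ∎)
    where
    open ≡-Reasoning
    const-1 : ∀ k → const -1ℤ k ≡ -1ℤ * const 1ℤ k
    const-1 zero    = refl
    const-1 (suc k) = refl

  -- Off the diagonal, H κ̄ = -δ expresses -H_st as a sum of products of lower degree.
  chow-DegLt : ∀ {s t} → s ≺ t → (∀ {w} → s ≼ w → w ≺ t → DegLe (H s w) (ρ s w)) → DegLt (H s t) (ρ s t)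
  chow-DegLt {s} {t} s≺t IH k ρ≤k = ℤ.*-cancelˡ-≡ -1ℤ (H s t k) 0ℤ (begin
    -1ℤ * H s t k             ≡⟨ ⋆-const -1ℤ (H s t) k ⟨
    (H s t ⋆ const -1ℤ) k     ≡⟨ ⋆-congˡ (H s t) (κ̄-diag t) k ⟨
    (H s t ⋆ κ̄ t t) k         ≡⟨ ∑-interval-top (λ w → (H s w ⋆ κ̄ w t) k) (proj₁ s≺t) lower-terms ⟨
    (H ∙ κ̄) s t k             ≡⟨ trans (proj₂ H∙κ̄≈-δ s t s≺t k) (const0 k) ⟩
    0ℤ                        ∎)
    where
    open ≡-Reasoning
    lower-terms : ∀ w → s ≼ w → w ≺ t → (H s w ⋆ κ̄ w t) k ≡ 0ℤ
    lower-terms w s≼w w≺t = ⋆-DegLt (IH s≼w w≺t) (reduced-DegLt w≺t) k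
      (subst (_≤ k) (additive s w t s≼w (proj₁ w≺t)) ρ≤k)

  chow-InIρ : InIρ P ρ H
  chow-InIρ s t = rank-induction (λ s t → DegLe (H s t) (ρ s t)) step
    where
    step : ∀ {s t} → s ≼ t → (∀ {w} → s ≼ w → w ≺ t → DegLe (H s w) (ρ s w)) → DegLe (H s t) (ρ s t)
    step {s} s≼t IH k ρ<k = ≼-caseℤ s≼t
      (λ { refl → on-diagonal k ρ<k })
      (λ s≺t → chow-DegLt s≺t IH k (ℕ.<⇒≤ ρ<k))
      where
      on-diagonal : ∀ k → ρ s s < k → H s s k ≡ 0ℤ
      on-diagonal (suc k) _ = chow-diag s (suc k)

  chow-top-vanishes : ∀ {s t} → s ≺ t → H s t (ρ s t) ≡ 0ℤ
  chow-top-vanishes {s} {t} s≺t = chow-DegLt s≺t (λ {w} s≼w _ → chow-InIρ s w s≼w) (ρ s t) ℕ.≤-refl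

  chowʳ∙reducedʳ≈-δ : IsScalarδ P -1ℤ (H ʳ ∙ κ̄ ʳ)
  chowʳ∙reducedʳ≈-δ = IsScalarδ-resp (ʳ-∙ chow-InIρ reduced-InIρ) (IsScalarδ-ʳ H∙κ̄≈-δ)

  reducedʳ∙chowʳ≈-δ : IsScalarδ P -1ℤ (κ̄ ʳ ∙ H ʳ)
  reducedʳ∙chowʳ≈-δ = IsScalarδ-resp (ʳ-∙ reduced-InIρ chow-InIρ) (IsScalarδ-ʳ κ̄∙H≈-δ)

  chowʳ≈κ∙chow : H ʳ ≈ κ ∙ H
  chowʳ≈κ∙chow = inverse-unique (H ʳ) (κ̄ ʳ) (κ ∙ H) chowʳ∙reducedʳ≈-δ (IsScalarδ-resp (≈ᵢ-sym (begin
    κ̄ ʳ ∙ (κ ∙ H)   ≈⟨ ∙-assoc (κ̄ ʳ) κ H ⟨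
    (κ̄ ʳ ∙ κ) ∙ H   ≈⟨ ∙-congʳ H reduced-ʳ-∙ ⟩
    κ̄ ∙ H           ∎)) κ̄∙H≈-δ)
    where open ≈ᵢ-Reasoning

  chowʳ≈chow∙κ : H ʳ ≈ H ∙ κ
  chowʳ≈chow∙κ = ≈ᵢ-sym (inverse-unique (H ∙ κ) (κ̄ ʳ) (H ʳ) (IsScalarδ-resp (≈ᵢ-sym (begin
    (H ∙ κ) ∙ κ̄ ʳ   ≈⟨ ∙-assoc H κ (κ̄ ʳ) ⟩
    H ∙ (κ ∙ κ̄ ʳ)   ≈⟨ ∙-congˡ H ∙-reduced-ʳ ⟩
    H ∙ κ̄           ∎)) H∙κ̄≈-δ) reducedʳ∙chowʳ≈-δ)
    where open ≈ᵢ-Reasoning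

  chow≈κʳ∙chowʳ : H ≈ κ ʳ ∙ H ʳ
  chow≈κʳ∙chowʳ = begin
    H               ≈⟨ 1·ᵢ H ⟨
    1ℤ ·ᵢ H         ≈⟨ δ-∙ invLeft H ⟨
    (κ ʳ ∙ κ) ∙ H   ≈⟨ ∙-assoc (κ ʳ) κ H ⟩
    κ ʳ ∙ (κ ∙ H)   ≈⟨ ∙-congˡ (κ ʳ) chowʳ≈κ∙chow ⟨
    κ ʳ ∙ H ʳ       ∎
    where open ≈ᵢ-Reasoning

  chow-coeff₀ : ∀ {s t} → s ≼ t → H s t 0 ≡ κ s t (ρ s t)
  chow-coeff₀ {s} {t} s≼t = trans (chow≈κʳ∙chowʳ s t s≼t 0)
    (∙-coeff₀-top (κ ʳ) (H ʳ) s≼t (ʳ-diag H t (chow-diag t) 0) (λ w _ w≺t → chow-top-vanishes w≺t))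

module AugmentedChow {c ℓ} (P : LocallyFinitePoset c ℓ)
                     (ρ : Carrier P → Carrier P → ℕ) (ρ-rank : IsWeakRank P ρ)
                     (κ : Inc P) (κ-kernel : IsKernel P ρ κ)
                     (κ̄ : Inc P) (κ̄-reduced : IsReducedKernel P κ κ̄)
                     (H : Inc P) (H-chow : IsChowFunction P κ̄ H) where

  open Incidence P
  open Ranked P ρ ρ-rank
  open Chow P ρ ρ-rank κ κ-kernel κ̄ κ̄-reduced H H-chow

  module Right (f : Inc P) (f-kls : IsRightKLS P ρ κ f) where

    open IsRightKLS f-kls

    F : Inc P
    F = rightAugChow P ρ H f

    F-palindromic : F ʳ ≈ F
    F-palindromic = begin
      (H ∙ f ʳ) ʳ     ≈⟨ ʳ-∙ chow-InIρ (ʳ-InIρ f) ⟩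
      H ʳ ∙ f ʳ ʳ     ≈⟨ ∙-congˡ (H ʳ) (ʳ-involutive inIρ) ⟩
      H ʳ ∙ f         ≈⟨ ∙-congʳ f chowʳ≈chow∙κ ⟩
      (H ∙ κ) ∙ f     ≈⟨ ∙-assoc H κ f ⟩
      H ∙ (κ ∙ f)     ≈⟨ ∙-congˡ H eqn ⟨
      H ∙ f ʳ         ∎
      where open ≈ᵢ-Reasoning

    F-top : ∀ {s t} → s ≼ t → F s t (ρ s t) ≡ κ s t (ρ s t)
    F-top {s} {t} s≼t = begin
      F s t (ρ s t)   ≡⟨ F-palindromic s t s≼t 0 ⟩
      F s t 0         ≡⟨ ∙-coeff₀-top H (f ʳ) s≼t (ʳ-diag f t (diag t) 0)
                                        (λ w _ w≺t → DegLtHalf⇒top-vanishes (small w t w≺t)) ⟩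
      H s t 0         ≡⟨ chow-coeff₀ s≼t ⟩
      κ s t (ρ s t)   ∎
      where open ≡-Reasoning

  module Left (g : Inc P) (g-kls : IsLeftKLS P ρ κ g) where

    open IsLeftKLS g-kls

    G : Inc P
    G = leftAugChow P ρ H g

    G-palindromic : G ʳ ≈ G
    G-palindromic = begin
      (g ʳ ∙ H) ʳ     ≈⟨ ʳ-∙ (ʳ-InIρ g) chow-InIρ ⟩
      g ʳ ʳ ∙ H ʳ     ≈⟨ ∙-congʳ (H ʳ) (ʳ-involutive inIρ) ⟩
      g ∙ H ʳ         ≈⟨ ∙-congˡ g chowʳ≈κ∙chow ⟩
      g ∙ (κ ∙ H)     ≈⟨ ∙-assoc g κ H ⟨
      (g ∙ κ) ∙ H     ≈⟨ ∙-congʳ H eqn ⟨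
      g ʳ ∙ H         ∎
      where open ≈ᵢ-Reasoning

    G-top : ∀ {s t} → s ≼ t → G s t (ρ s t) ≡ κ s t (ρ s t)
    G-top {s} {t} s≼t = begin
      G s t (ρ s t)   ≡⟨ G-palindromic s t s≼t 0 ⟩
      G s t 0         ≡⟨ ∙-coeff₀-bottom (g ʳ) H s≼t (ʳ-diag g s (diag s) 0)
                                           (λ w s≺w _ → DegLtHalf⇒top-vanishes (small s w s≺w)) ⟩
      H s t 0         ≡⟨ chow-coeff₀ s≼t ⟩
      κ s t (ρ s t)   ∎
      where open ≡-Reasoning

proposition3p15 : ∀ {c ℓ} (P : LocallyFinitePoset c ℓ)
    (ρ : Carrier P → Carrier P → ℕ) → IsWeakRank P ρ →
    (κ : Inc P) → IsKernel P ρ κ →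
    (κ̄ : Inc P) → IsReducedKernel P κ κ̄ →
    (H : Inc P) → IsChowFunction P κ̄ H →
    (f : Inc P) → IsRightKLS P ρ κ f →
    (g : Inc P) → IsLeftKLS P ρ κ g →
    -- (i) top coefficients
    ((∀ s t → _≤P_ P s t →
        (rightAugChow P ρ H f s t (ρ s t) ≡ κ s t (ρ s t))
      × (leftAugChow P ρ H g s t (ρ s t) ≡ κ s t (ρ s t)))
    × (NonDegenerate P ρ κ →
        ∀ s t → _≤P_ P s t →
          HasDeg (rightAugChow P ρ H f s t) (ρ s t)
        × HasDeg (leftAugChow P ρ H g s t) (ρ s t)))
    -- (ii) palindromicity: F^rev = F and G^rev = G
    × (_≈ᵢ_ P (rev P ρ (rightAugChow P ρ H f)) (rightAugChow P ρ H f)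
      × _≈ᵢ_ P (rev P ρ (leftAugChow P ρ H g)) (leftAugChow P ρ H g))
proposition3p15 P ρ ρ-rank κ κ-kernel κ̄ κ̄-reduced H H-chow f f-kls g g-kls =
  ( (λ s t s≼t → F-top s≼t , G-top s≼t)
  , (λ κ-nondegenerate s t s≼t → let κ-top≢0 = proj₁ (κ-nondegenerate s t s≼t) in
         palindromic-HasDeg F-palindromic s≼t (κ-top≢0 ∘ trans (sym (F-top s≼t)))
       , palindromic-HasDeg G-palindromic s≼t (κ-top≢0 ∘ trans (sym (G-top s≼t)))) )
  , F-palindromic , G-palindromic
  where
  open Ranked P ρ ρ-rank
  open AugmentedChow P ρ ρ-rank κ κ-kernel κ̄ κ̄-reduced H H-chow
  open Right f f-kls
  open Left g g-kls
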